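{- Every noncyclic $3$-group of order at most $27$ is colourable.
   Context: A bijection $\sigma$ of a group $G$ is a colouring bijection if the maps $x\mapsto\sigma(x)x$, $x\mapsto x^{ -1}\sigma(x)$, $x\mapsto x^{ -1}\sigma(x)x$ are all bijections of $G$; $G$ is colourable if it admits a colouring bijection. -}

module Defs where

open import Level using (Level; _⊔_)
open import Data.Nat using (ℕ; zero; suc; _^_; _≤_)
open import Data.Integer using (ℤ; +_; -[1+_])
open import Data.Fin using (Fin)
open import Data.Product using (Σ; ∃; _×_)
open import Relation.Nullary using (¬_)
open import Relation.Binary.PropositionalEquality using (_≡_)
import Relation.Binary.PropositionalEquality as PE
open import Function.Definitions using (Bijective)
open import Function.Bundles using (Bijection; Inverse)
open import Algebra.Bundles using (Group)

module _ {c ℓ : Level} (G : Group c ℓ) where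
  open Group G

  powℕ : Carrier → ℕ → Carrier
  powℕ g zero    = ε
  powℕ g (suc n) = g ∙ powℕ g n

  powℤ : Carrier → ℤ → Carrier
  powℤ g (+ n)      = powℕ g n
  powℤ g -[1+ n ]   = (powℕ g (suc n)) ⁻¹

  IsCyclic : Set (c ⊔ ℓ)
  IsCyclic = ∃ λ (g : Carrier) → ∀ (x : Carrier) → ∃ λ (m : ℤ) → x ≈ powℤ g m

  HasOrder : ℕ → Set (c ⊔ ℓ)
  HasOrder n = Inverse (PE.setoid (Fin n)) setoid

  IsColouring : (Carrier → Carrier) → Set (c ⊔ ℓ)
  IsColouring σ =
      Bijective _≈_ _≈_ (λ x → σ x ∙ x)
    × Bijective _≈_ _≈_ (λ x → x ⁻¹ ∙ σ x)
    × Bijective _≈_ _≈_ (λ x → (x ⁻¹ ∙ σ x) ∙ x)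

  Colourable : Set (c ⊔ ℓ)
  Colourable = Σ (Bijection setoid setoid) λ σ → IsColouring (Bijection.to σ)

  Is3GroupOfOrder≤27 : Set (c ⊔ ℓ)
  Is3GroupOfOrder≤27 = ∃ λ (k : ℕ) → HasOrder (3 ^ k) × (3 ^ k ≤ 27)

{-# OPTIONS --safe #-}

-- By Lagrange's theorem a noncyclic one has
-- exponent n/3.  If it has an element a of order p = n/3, then ⟨a⟩ has index 3 and is normal (a permutes
-- the three cosets, fixes ⟨a⟩ and has odd order, so it cannot swap the other two); any b ∉ ⟨a⟩ then gives
-- the presentation b a = aʳ b, b³ = aᵐ with r³ ≡ 1 and (p/3)·m ≡ 0 (mod p).  Otherwise n = 27 and the
-- exponent is 3, so the commutator c of two noncommuting elements a, b is central and c, a, b present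
-- the Heisenberg group; an abelian group of exponent 3 is presented by any three independent elements.
-- Each presentation identifies the group with an explicit multiplication table on Fin n, and a colouring
-- bijection of that table is checked by computation.
module Submission where

open import Defs
open import Level using (Level; _⊔_; 0ℓ)

open import Algebra.Bundles using (Group)
open import Algebra.Core using (Op₁; Op₂)
open import Algebra.Structures using (IsGroup)
import Algebra.Properties.Group as GroupProperties
import Algebra.Properties.Monoid.Mult as MonoidMult
open import Data.Empty using (⊥-elim)
open import Data.Fin.Base using (Fin; zero; suc; toℕ; fromℕ<; punchOut; remQuot; combine)
open import Data.Fin.Patterns using (0F; 1F; 2F; 3F; 4F; 6F; 7F)
open import Data.Fin.Properties
  using (_≟_; any?; all?; ¬∀⟶∃¬; ¬∀⟶∃¬-smallest; pigeonhole; injective⇒≤; punchOut-injective; suc-injective;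
         toℕ<n; toℕ-fromℕ<; toℕ-inject; toℕ-injective; *↔×; remQuot-combine; combine-remQuot)
open import Data.Integer.Base using (+_; -[1+_])
import Data.Nat.Base as ℕ
open import Data.Nat.Base
  using (ℕ; zero; suc; _+_; _*_; _∸_; _≤_; _<_; z≤n; s≤s; z<s; s≤s⁻¹; s<s⁻¹; NonZero; >-nonZero)
open import Data.Nat.DivMod using (_%_; _/_; _mod_; m≡m%n+[m/n]*n; m%n<n; m<n⇒m%n≡m)
open import Data.Nat.Divisibility
  using (_∣_; divides; _∣0; ∣-refl; ∣1⇒≡1; ∣m∣n⇒∣m+n; m∣m*n; n∣m*n; *-cancelʳ-∣; *-monoˡ-∣; m%n≡0⇒n∣m; n∣m⇒m%n≡0)
open import Data.Nat.GeneralisedArithmetic using (fold; iterate)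
open import Data.Nat.Primality using (Prime; prime?; euclidsLemma; prime⇒nonZero)
open import Data.Nat.Properties
  using (+-comm; +-suc; *-comm; *-assoc; *-suc; *-zeroʳ; *-identityˡ; *-identityʳ; *-cancelˡ-≡; suc-pred;
         ≤-reflexive; ≤-trans; ≤-pred; ≤-<-trans; <-≤-trans; <-cmp; <-irrefl; <⇒≱; n≮0; n<1+n;
         m≤m+n; m≤n+m; m<n+m; m<m*n; m≤n⇒∃[o]m+o≡n; ^-monoʳ-≤; _<?_)
  renaming (_≟_ to _≟ℕ_)
open import Data.Product.Base using (_,_; proj₁; proj₂; _×_; ∃; uncurry)
open import Data.Product.Function.NonDependent.Propositional using (_×-↔_)
open import Data.Sum.Base using (_⊎_; inj₁; inj₂)
open import Data.Unit.Base using (⊤; tt)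
open import Data.Vec.Base using (Vec; []; _∷_; lookup; replicate; tabulate)
open import Data.Vec.Properties using (lookup∘tabulate)
open import Data.Vec.Relation.Unary.AllPairs using (allPairs?)
open import Data.Vec.Relation.Unary.Unique.Propositional using (Unique)
open import Data.Vec.Relation.Unary.Unique.Propositional.Properties using (lookup-injective)
open import Function.Base using (_∘_; id; case_of_)
open import Function.Bundles using (Inverse; Bijection; _↔_)
open import Function.Definitions using (Bijective; Injective)
import Function.Construct.Composition as Compose
import Function.Construct.Symmetry as Symmetry
open import Function.Properties.Inverse using (Inverse⇒Bijection; ↔-trans; ↔-refl)
open import Relation.Binary.Definitions using (tri<; tri≈; tri>)
open import Relation.Binary.PropositionalEquality as ≡ using (_≡_; _≢_)
import Relation.Binary.Reasoning.Setoid as SetoidReasoning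
open import Relation.Nullary using (¬_; Dec; yes; no; contradiction)
open import Relation.Nullary.Decidable using (¬?; decidable-stable; _×-dec_; _→-dec_; toWitness)
open import Relation.Unary using (Pred; Decidable; _∩_; ∁)
open import Relation.Unary.Properties using (_∩?_; ∁?)

private
  variable
    c₁ c₂ ℓ₁ ℓ₂ : Level

-- Group isomorphisms and copies on Fin n

record GroupIsomorphism (H : Group c₁ ℓ₁) (G : Group c₂ ℓ₂) : Set (c₁ ⊔ ℓ₁ ⊔ c₂ ⊔ ℓ₂) where
  private
    module H = Group H
    module G = Group G
  field
    inverse : Inverse H.setoid G.setoid
  open Inverse inverse public hiding (inverse)
  field
    homo : ∀ x y → to (x H.∙ y) G.≈ to x G.∙ to y

module _ {H : Group c₁ ℓ₁} {G : Group c₂ ℓ₂} (iso : GroupIsomorphism H G) where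
  private
    module H = Group H
  open Group G
  open GroupProperties G using (identityˡ-unique; inverseˡ-unique)
  open GroupIsomorphism iso

  private
    bijective-pointwise : ∀ {f g : Carrier → Carrier} → Bijective _≈_ _≈_ g →
                          (∀ x → f x ≈ g x) → Bijective _≈_ _≈_ f
    bijective-pointwise (g-inj , g-surj) f≈g =
      (λ {x} {y} fx≈fy → g-inj (trans (sym (f≈g x)) (trans fx≈fy (f≈g y)))) ,
      (λ y → proj₁ (g-surj y) , λ z≈x → trans (f≈g _) (proj₂ (g-surj y) z≈x))

  to-ε : to H.ε ≈ ε
  to-ε = identityˡ-unique _ _ (trans (sym (homo H.ε H.ε)) (to-cong (H.identityˡ H.ε)))

  to-⁻¹ : ∀ x → to (x H.⁻¹) ≈ to x ⁻¹
  to-⁻¹ x = inverseˡ-unique _ _ (trans (sym (homo (x H.⁻¹) x)) (trans (to-cong (H.inverseˡ x)) to-ε))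

  to-powℕ : ∀ x k → to (powℕ H x k) ≈ powℕ G (to x) k
  to-powℕ x ℕ.zero    = to-ε
  to-powℕ x (ℕ.suc k) = trans (homo x (powℕ H x k)) (∙-congˡ (to-powℕ x k))

  to-powℤ : ∀ x m → to (powℤ H x m) ≈ powℤ G (to x) m
  to-powℤ x (+ k)    = to-powℕ x k
  to-powℤ x -[1+ k ] = trans (to-⁻¹ (powℕ H x (ℕ.suc k))) (⁻¹-cong (to-powℕ x (ℕ.suc k)))

  isCyclic-transport : IsCyclic H → IsCyclic G
  isCyclic-transport (g , generates) = to g , λ y →
    let m , y≈gᵐ = generates (from y) in
    m , trans (sym (strictlyInverseˡ y)) (trans (to-cong y≈gᵐ) (to-powℤ g m))

  colourable-transport : Colourable H → Colourable G
  colourable-transport (σ , σx∙x-bij , x⁻¹∙σx-bij , conj-bij) =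
    σ′ , bijective-pointwise (conjugate σx∙x-bij) σ′x∙x
       , bijective-pointwise (conjugate x⁻¹∙σx-bij) x⁻¹∙σ′x
       , bijective-pointwise (conjugate conj-bij)
           (λ x → trans (∙-cong (x⁻¹∙σ′x x) (sym (strictlyInverseˡ x))) (sym (homo _ _)))
    where
    module σ = Bijection σ

    conjugate : ∀ {f} → Bijective H._≈_ H._≈_ f → Bijective _≈_ _≈_ (to ∘ f ∘ from)
    conjugate f-bij = Compose.bijective _≈_ H._≈_ _≈_ (Compose.bijective _≈_ H._≈_ H._≈_ from-bij f-bij) to-bij
      where
      to-bij : Bijective H._≈_ _≈_ to
      to-bij = Bijection.bijective (Inverse⇒Bijection (GroupIsomorphism.inverse iso))

      from-bij : Bijective _≈_ H._≈_ from
      from-bij = Bijection.bijective (Inverse⇒Bijection (Symmetry.inverse (GroupIsomorphism.inverse iso)))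

    σ′ : Bijection setoid setoid
    σ′ = record
      { to        = to ∘ σ.to ∘ from
      ; cong      = to-cong ∘ σ.cong ∘ from-cong
      ; bijective = conjugate σ.bijective
      }

    σ′x∙x : ∀ x → Bijection.to σ′ x ∙ x ≈ to (σ.to (from x) H.∙ from x)
    σ′x∙x x = sym (trans (homo _ _) (∙-congˡ (strictlyInverseˡ x)))

    x⁻¹∙σ′x : ∀ x → x ⁻¹ ∙ Bijection.to σ′ x ≈ to (from x H.⁻¹ H.∙ σ.to (from x))
    x⁻¹∙σ′x x = sym (trans (homo _ _) (∙-congʳ (trans (to-⁻¹ (from x)) (⁻¹-cong (strictlyInverseˡ x)))))

record FinGroup (n : ℕ) : Set where
  infixl 7 _∙_
  infix 8 _⁻¹
  field
    _∙_     : Op₂ (Fin n)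
    ε       : Fin n
    _⁻¹     : Op₁ (Fin n)
    isGroup : IsGroup _≡_ _∙_ ε _⁻¹

  group : Group 0ℓ 0ℓ
  group = record { Carrier = Fin n ; _≈_ = _≡_ ; _∙_ = _∙_ ; ε = ε ; _⁻¹ = _⁻¹ ; isGroup = isGroup }

module _ {c ℓ} (G : Group c ℓ) {n : ℕ} (I : HasOrder G n) where
  open Group G
  open Inverse I using (to; from; from-cong; strictlyInverseˡ; strictlyInverseʳ)
  open SetoidReasoning setoid

  finGroup : FinGroup n
  finGroup = record
    { _∙_     = _·_
    ; ε       = from ε
    ; _⁻¹     = inv
    ; isGroup = record
      { isMonoid = record
        { isSemigroup = record
          { isMagma = record { isEquivalence = ≡.isEquivalence ; ∙-cong = ≡.cong₂ _·_ }
          ; assoc   = λ i j k → from-cong (begin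
              to (i · j) ∙ to k     ≈⟨ ∙-congʳ (strictlyInverseˡ _) ⟩
              (to i ∙ to j) ∙ to k  ≈⟨ assoc _ _ _ ⟩
              to i ∙ (to j ∙ to k)  ≈⟨ ∙-congˡ (strictlyInverseˡ _) ⟨
              to i ∙ to (j · k)     ∎)
          }
        ; identity = (λ i → ≡.trans (from-cong (trans (∙-congʳ (strictlyInverseˡ ε)) (identityˡ _)))
                                    (strictlyInverseʳ i))
                   , (λ i → ≡.trans (from-cong (trans (∙-congˡ (strictlyInverseˡ ε)) (identityʳ _)))
                                    (strictlyInverseʳ i))
        }
      ; inverse = (λ i → from-cong (trans (∙-congʳ (strictlyInverseˡ _)) (inverseˡ _)))
                , (λ i → from-cong (trans (∙-congˡ (strictlyInverseˡ _)) (inverseʳ _)))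
      ; ⁻¹-cong = ≡.cong inv
      }
    }
    where
    _·_ : Op₂ (Fin n)
    i · j = from (to i ∙ to j)

    inv : Op₁ (Fin n)
    inv i = from (to i ⁻¹)

  finGroup-isomorphism : GroupIsomorphism (FinGroup.group finGroup) G
  finGroup-isomorphism = record
    { inverse = record
      { to        = to
      ; from      = from
      ; to-cong   = λ { ≡.refl → refl }
      ; from-cong = from-cong
      ; inverse   = (λ { ≡.refl → strictlyInverseˡ _ })
                  , (λ y≈to-x → ≡.trans (from-cong y≈to-x) (strictlyInverseʳ _))
      }
    ; homo = λ i j → strictlyInverseˡ _
    }

open ≡ using (refl; sym; trans; cong; cong₂; subst)
open ≡.≡-Reasoning

-- Finite sets and counting

injective⇒surjective : ∀ {n} {f : Fin n → Fin n} → Injective _≡_ _≡_ f → ∀ y → ∃ λ x → f x ≡ y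
injective⇒surjective {suc n} {f} f-inj y with any? (λ x → f x ≟ y)
... | yes hit  = hit
... | no  miss = contradiction (injective⇒≤ punchOut-f-injective) (<-irrefl refl)
  where
  y≢f : ∀ x → y ≢ f x
  y≢f x y≡fx = miss (x , sym y≡fx)

  punchOut-f : Fin (suc n) → Fin n
  punchOut-f x = punchOut (y≢f x)

  punchOut-f-injective : Injective _≡_ _≡_ punchOut-f
  punchOut-f-injective {x} {z} = f-inj ∘ punchOut-injective (y≢f x) (y≢f z)

injective⇒surjective′ : ∀ {m n} {f : Fin m → Fin n} → m ≡ n → Injective _≡_ _≡_ f → ∀ y → ∃ λ x → f x ≡ y
injective⇒surjective′ refl = injective⇒surjective

injective⇒bijective : ∀ {n} {f : Fin n → Fin n} → Injective _≡_ _≡_ f → Bijective _≡_ _≡_ f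
injective⇒bijective f-inj = f-inj , λ y →
  let x , fx≡y = injective⇒surjective f-inj y in x , λ { refl → fx≡y }

outside : ∀ {m n} (f : Fin m → Fin n) → m < n → ∃ λ y → ∀ i → f i ≢ y
outside {m} {n} f m<n with any? (λ y → all? (λ i → ¬? (f i ≟ y)))
... | yes missed  = missed
... | no  ¬missed = contradiction (injective⇒≤ preimage-injective) (<⇒≱ m<n)
  where
  preimage : ∀ y → ∃ λ i → f i ≡ y
  preimage y with ¬∀⟶∃¬ m _ (λ i → ¬? (f i ≟ y)) (λ ∀i → ¬missed (y , ∀i))
  ... | i , ¬fi≢y = i , decidable-stable (f i ≟ y) ¬fi≢y

  preimage-injective : Injective _≡_ _≡_ (proj₁ ∘ preimage)
  preimage-injective {y} {z} i≡j =
    trans (sym (proj₂ (preimage y))) (trans (cong f i≡j) (proj₂ (preimage z)))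

unique-tabulate⇒injective : ∀ {n} {f : Fin n → Fin n} → Unique (tabulate f) → Injective _≡_ _≡_ f
unique-tabulate⇒injective {f = f} unique {i} {j} fi≡fj =
  lookup-injective unique i j (trans (lookup∘tabulate f i) (trans fi≡fj (sym (lookup∘tabulate f j))))

unique? : ∀ {k n} (v : Vec (Fin n) k) → Dec (Unique v)
unique? = allPairs? (λ x y → ¬? (x ≟ y))

count : ∀ {n} {P : Pred (Fin n) 0ℓ} → Decidable P → ℕ
count {zero}  P? = 0
count {suc n} P? with P? zero
... | yes _ = suc (count (P? ∘ suc))
... | no  _ = count (P? ∘ suc)

count-cong : ∀ {n} {P Q : Pred (Fin n) 0ℓ} (P? : Decidable P) (Q? : Decidable Q) →
             (∀ z → P z → Q z) → (∀ z → Q z → P z) → count P? ≡ count Q?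
count-cong {zero}  P? Q? P⇒Q Q⇒P = refl
count-cong {suc n} P? Q? P⇒Q Q⇒P with P? zero | Q? zero
... | yes _ | yes _ = cong suc (count-cong (P? ∘ suc) (Q? ∘ suc) (P⇒Q ∘ suc) (Q⇒P ∘ suc))
... | no  _ | no  _ = count-cong (P? ∘ suc) (Q? ∘ suc) (P⇒Q ∘ suc) (Q⇒P ∘ suc)
... | yes p | no ¬q = contradiction (P⇒Q zero p) ¬q
... | no ¬p | yes q = contradiction (Q⇒P zero q) ¬p

count-∅ : ∀ {n} {P : Pred (Fin n) 0ℓ} (P? : Decidable P) → (∀ z → ¬ P z) → count P? ≡ 0
count-∅ {zero}  P? ¬P = refl
count-∅ {suc n} P? ¬P with P? zero
... | yes p = contradiction p (¬P zero)
... | no  _ = count-∅ (P? ∘ suc) (¬P ∘ suc)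

count-U : ∀ {n} {P : Pred (Fin n) 0ℓ} (P? : Decidable P) → (∀ z → P z) → count P? ≡ n
count-U {zero}  P? allP = refl
count-U {suc n} P? allP with P? zero
... | yes _ = cong suc (count-U (P? ∘ suc) (allP ∘ suc))
... | no ¬p = contradiction (allP zero) ¬p

count-split : ∀ {n} {P Q : Pred (Fin n) 0ℓ} (P? : Decidable P) (Q? : Decidable Q) →
              count P? ≡ count (P? ∩? Q?) + count (P? ∩? ∁? Q?)
count-split {zero}  P? Q? = refl
count-split {suc n} P? Q? with P? zero | Q? zero | count-split (P? ∘ suc) (Q? ∘ suc)
... | yes _ | yes _ | rest = cong suc rest
... | yes _ | no  _ | rest = trans (cong suc rest) (sym (+-suc _ _))
... | no  _ | _     | rest = rest

count-singleton : ∀ {n} (c : Fin n) → count (_≟ c) ≡ 1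
count-singleton {suc n} zero    = cong suc (count-∅ {n} (λ z → suc z ≟ zero) (λ z ()))
count-singleton {suc n} (suc c) =
  trans (count-cong _ (_≟ c) (λ z → suc-injective) (λ z → cong suc)) (count-singleton c)

count-image : ∀ {d n} (f : Fin d → Fin n) → Injective _≡_ _≡_ f → count (λ z → any? (λ i → f i ≟ z)) ≡ d
count-image {zero}  f _     = count-∅ (λ z → any? (λ i → f i ≟ z)) (λ { z (() , _) })
count-image {suc d} f f-inj = begin
  count image?                                                   ≡⟨ count-split image? (_≟ f zero) ⟩
  count (image? ∩? (_≟ f zero)) + count (image? ∩? ∁? (_≟ f zero)) ≡⟨ cong₂ _+_ count-head count-tail ⟩
  1 + d                                                          ∎
  where
  image? : Decidable (λ z → ∃ λ i → f i ≡ z)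
  image? z = any? (λ i → f i ≟ z)

  count-head : count (image? ∩? (_≟ f zero)) ≡ 1
  count-head = trans (count-cong (image? ∩? (_≟ f zero)) (_≟ f zero)
                                 (λ z → proj₂) (λ z z≡f0 → (zero , sym z≡f0) , z≡f0))
                     (count-singleton (f zero))

  from-tail : ∀ z → (∃ λ i → f i ≡ z) × z ≢ f zero → ∃ λ i → f (suc i) ≡ z
  from-tail z ((zero  , f0≡z) , z≢f0) = contradiction (sym f0≡z) z≢f0
  from-tail z ((suc i , fi≡z) , _)    = i , fi≡z

  to-tail : ∀ z → (∃ λ i → f (suc i) ≡ z) → (∃ λ i → f i ≡ z) × z ≢ f zero
  to-tail z (i , fi≡z) = (suc i , fi≡z) , λ z≡f0 → case f-inj (trans fi≡z z≡f0) of λ ()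

  count-tail : count (image? ∩? ∁? (_≟ f zero)) ≡ d
  count-tail = trans (count-cong (image? ∩? ∁? (_≟ f zero)) (λ z → any? (λ i → f (suc i) ≟ z)) from-tail to-tail)
                     (count-image (f ∘ suc) (suc-injective ∘ f-inj))

module _ {σ : Fin 3 → Fin 3} (σ-injective : ∀ {s t} → σ s ≡ σ t → s ≡ t) where
  iterate-involution : ∀ {s} → σ (σ s) ≡ s → ∀ h → iterate σ s (2 * h) ≡ s
  iterate-involution σσs≡s zero    = refl
  iterate-involution {s} σσs≡s (suc h) =
    trans (cong (iterate σ s) (*-suc 2 h))
          (trans (cong (λ t → iterate σ t (2 * h)) σσs≡s) (iterate-involution σσs≡s h))

  odd-iterate-fixes-1F : σ 0F ≡ 0F → ∀ h → iterate σ 1F (suc (2 * h)) ≡ 1F → σ 1F ≡ 1F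
  odd-iterate-fixes-1F σ0≡0 h σ¹⁺²ʰ1≡1 = go (σ 1F) (σ 2F) refl refl
    where
    go : ∀ s₁ s₂ → σ 1F ≡ s₁ → σ 2F ≡ s₂ → σ 1F ≡ 1F
    go 0F _  σ1≡0 _    = contradiction (σ-injective (trans σ1≡0 (sym σ0≡0))) λ ()
    go 1F _  σ1≡1 _    = σ1≡1
    go 2F 0F _    σ2≡0 = contradiction (σ-injective (trans σ2≡0 (sym σ0≡0))) λ ()
    go 2F 1F σ1≡2 σ2≡1 = contradiction (trans (sym σ¹⁺²ʰ1≡1)
      (trans (cong (λ t → iterate σ t (2 * h)) σ1≡2) (iterate-involution (trans (cong σ σ2≡1) σ1≡2) h))) λ ()
    go 2F 2F σ1≡2 σ2≡2 = contradiction (σ-injective (trans σ2≡2 (sym σ1≡2))) λ ()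

  third-value : σ 0F ≡ 1F → σ 1F ≡ 2F → σ 2F ≡ 0F
  third-value σ0≡1 σ1≡2 = go (σ 2F) refl
    where
    go : ∀ s → σ 2F ≡ s → σ 2F ≡ 0F
    go 0F σ2≡0 = σ2≡0
    go 1F σ2≡1 = contradiction (σ-injective (trans σ2≡1 (sym σ0≡1))) λ ()
    go 2F σ2≡2 = contradiction (σ-injective (trans σ2≡2 (sym σ1≡2))) λ ()

-- Divisors of prime powers

module _ {p} (p-prime : Prime p) where
  private instance
    p≢0 : NonZero p
    p≢0 = prime⇒nonZero p-prime

  ∣p^[1+k]⇒≡∨∣p^k : ∀ k {d} → d ∣ p ℕ.^ suc k → d ≡ p ℕ.^ suc k ⊎ d ∣ p ℕ.^ k
  ∣p^[1+k]⇒≡∨∣p^k k {d} d∣p^[1+k]@(divides q p^[1+k]≡q*d)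
    with euclidsLemma q d p-prime (subst (p ∣_) p^[1+k]≡q*d (m∣m*n (p ℕ.^ k)))
  ... | inj₁ (divides q′ refl) = inj₂ (divides q′ (*-cancelˡ-≡ _ _ p (begin
    p * p ℕ.^ k    ≡⟨ p^[1+k]≡q*d ⟩
    q′ * p * d     ≡⟨ cong (_* d) (*-comm q′ p) ⟩
    p * q′ * d     ≡⟨ *-assoc p q′ d ⟩
    p * (q′ * d)   ∎)))
  ... | inj₂ (divides e refl) =
    multiple-of-p k (*-cancelʳ-∣ p (subst (e * p ∣_) (*-comm p (p ℕ.^ k)) d∣p^[1+k]))
    where
    multiple-of-p : ∀ k → e ∣ p ℕ.^ k → e * p ≡ p ℕ.^ suc k ⊎ e * p ∣ p ℕ.^ k
    multiple-of-p zero    e∣1 = inj₁ (trans (cong (_* p) (∣1⇒≡1 e∣1)) (*-comm 1 p))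
    multiple-of-p (suc k) e∣p^[1+k] with ∣p^[1+k]⇒≡∨∣p^k k e∣p^[1+k]
    ... | inj₁ e≡p^[1+k] = inj₁ (trans (cong (_* p) e≡p^[1+k]) (*-comm (p ℕ.^ suc k) p))
    ... | inj₂ e∣p^k     = inj₂ (subst (e * p ∣_) (*-comm (p ℕ.^ k) p) (*-monoˡ-∣ p e∣p^k))

prime-3 : Prime 3
prime-3 = toWitness {a? = prime? 3} _

-- Multiplication tables

-- In coordinates u bʲ: (u bʲ)(v bʲ′) = (u · θʲ v) bʲ⁺ʲ′, where b³ = μ is absorbed when j + j′ ≥ 3.
extension : {A : Set} → Op₂ A → (A → A) → A → Op₂ (A × Fin 3)
extension _⊕_ θ μ (u , j) (v , j′) =
  fold (u ⊕ fold v θ (toℕ j)) (_⊕ μ) ((toℕ j + toℕ j′) / 3) , (toℕ j + toℕ j′) mod 3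

addMod : ∀ p .{{_ : NonZero p}} → Op₂ (Fin p)
addMod p i j = (toℕ i + toℕ j) mod p

metacyclic : ∀ p .{{_ : NonZero p}} → Fin p → Fin p → Op₂ (Fin p × Fin 3)
metacyclic p r m = extension (addMod p) (λ i → (toℕ r * toℕ i) mod p) m

-- t = 0 gives the elementary abelian group of order 27, t = 1 the Heisenberg group over 𝔽₃.
heisenberg : ℕ → Op₂ ((Fin 3 × Fin 3) × Fin 3)
heisenberg t =
  extension (extension (addMod 3) id 0F) (λ (k , i) → (toℕ k + t * toℕ i) mod 3 , i) (0F , 0F)

enumeration₂₇ : Fin 27 ↔ ((Fin 3 × Fin 3) × Fin 3)
enumeration₂₇ = ↔-trans (*↔× {9} {3}) (*↔× {3} {3} ×-↔ ↔-refl)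

module MultiplicationTable {k} {M : Set} (enumeration : Fin k ↔ M) (_⋆_ : Op₂ M) (e : M) where
  open Inverse enumeration using (to; from)

  infixl 7 _·_
  _·_ : Op₂ (Fin k)
  u · v = from (to u ⋆ to v)

  1# : Fin k
  1# = from e

  -- The fallback is never used: `IsColouringTable` requires `inverse` to be a left inverse.
  inverse : Fin k → Fin k
  inverse u with any? (λ v → v · u ≟ 1#)
  ... | yes (v , _) = v
  ... | no  _       = u

  -- Injectivity is stated as `Unique (tabulate f)` so that deciding it evaluates each value of f only once.
  IsColouringTable : (Fin k → Fin k) → Set
  IsColouringTable σ = 1# · 1# ≡ 1# × (∀ u → inverse u · u ≡ 1#)
                     × Unique (tabulate σ) × Unique (tabulate (λ u → σ u · u))
                     × Unique (tabulate (λ u → inverse u · σ u))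
                     × Unique (tabulate (λ u → inverse u · σ u · u))

  isColouringTable? : ∀ σ → Dec (IsColouringTable σ)
  isColouringTable? σ = (1# · 1# ≟ 1#) ×-dec all? (λ u → inverse u · u ≟ 1#)
                     ×-dec unique? (tabulate σ) ×-dec unique? (tabulate (λ u → σ u · u))
                     ×-dec unique? (tabulate (λ u → inverse u · σ u))
                     ×-dec unique? (tabulate (λ u → inverse u · σ u · u))

module FinGroupTheory {n : ℕ} (G : FinGroup n) where
  open FinGroup G public
  open IsGroup isGroup public using (assoc; identityˡ; identityʳ; inverseˡ; inverseʳ)
  open GroupProperties group public
    using (∙-cancelˡ; ∙-cancelʳ; identityˡ-unique; inverseˡ-unique; inverseʳ-unique; ⁻¹-involutive;
           ⁻¹-anti-homo-∙; y≈x\\z)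
  private module Mult = MonoidMult (Group.monoid group)

  -- Powers and orders

  infixr 8 _^_
  _^_ : Fin n → ℕ → Fin n
  x ^ k = k Mult.× x

  ^-+ : ∀ x i j → x ^ (i + j) ≡ x ^ i ∙ x ^ j
  ^-+ x i j = Mult.×-homo-+ x i j

  ^-* : ∀ x i j → x ^ (i * j) ≡ (x ^ i) ^ j
  ^-* x i j = trans (cong (x ^_) (*-comm i j)) (sym (Mult.×-assocˡ x j i))

  ^-suc : ∀ x k → x ^ suc k ≡ x ^ k ∙ x
  ^-suc x zero    = trans (identityʳ x) (sym (identityˡ x))
  ^-suc x (suc k) = trans (cong (x ∙_) (^-suc x k)) (sym (assoc _ _ _))

  ε^ : ∀ k → ε ^ k ≡ ε
  ε^ zero    = refl
  ε^ (suc k) = trans (identityˡ _) (ε^ k)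

  ^-*-ε : ∀ x i → x ^ i ≡ ε → ∀ j → x ^ (i * j) ≡ ε
  ^-*-ε x i xⁱ≡ε j = trans (^-* x i j) (trans (cong (_^ j) xⁱ≡ε) (ε^ j))

  ^-% : ∀ {x d} .{{_ : NonZero d}} → x ^ d ≡ ε → ∀ k → x ^ k ≡ x ^ (k % d)
  ^-% {x} {d} xᵈ≡ε k = begin
    x ^ k                            ≡⟨ cong (x ^_) (trans (m≡m%n+[m/n]*n k d) (cong (_+_ (k % d)) (*-comm (k / d) d))) ⟩
    x ^ (k % d + d * (k / d))        ≡⟨ ^-+ x (k % d) (d * (k / d)) ⟩
    x ^ (k % d) ∙ x ^ (d * (k / d))  ≡⟨ cong (x ^ (k % d) ∙_) (^-*-ε x d xᵈ≡ε (k / d)) ⟩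
    x ^ (k % d) ∙ ε                  ≡⟨ identityʳ _ ⟩
    x ^ (k % d)                      ∎

  ^-mod : ∀ {x d} .{{_ : NonZero d}} → x ^ d ≡ ε → ∀ k → x ^ toℕ (k mod d) ≡ x ^ k
  ^-mod {x} {d} xᵈ≡ε k = trans (cong (x ^_) (toℕ-fromℕ< (m%n<n k d))) (sym (^-% xᵈ≡ε k))

  ^-cancel : ∀ x i k → x ^ i ≡ x ^ (i + k) → x ^ k ≡ ε
  ^-cancel x i k xⁱ≡xⁱ⁺ᵏ =
    sym (∙-cancelˡ (x ^ i) ε (x ^ k) (trans (identityʳ _) (trans xⁱ≡xⁱ⁺ᵏ (^-+ x i k))))

  commute-^ : ∀ {x y} → x ∙ y ≡ y ∙ x → ∀ k → x ∙ y ^ k ≡ y ^ k ∙ x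
  commute-^ {x} {y} xy≡yx zero    = trans (identityʳ x) (sym (identityˡ x))
  commute-^ {x} {y} xy≡yx (suc k) = begin
    x ∙ (y ∙ y ^ k)  ≡⟨ assoc x y (y ^ k) ⟨
    x ∙ y ∙ y ^ k    ≡⟨ cong (_∙ y ^ k) xy≡yx ⟩
    y ∙ x ∙ y ^ k    ≡⟨ assoc y x (y ^ k) ⟩
    y ∙ (x ∙ y ^ k)  ≡⟨ cong (y ∙_) (commute-^ xy≡yx k) ⟩
    y ∙ (y ^ k ∙ x)  ≡⟨ assoc y (y ^ k) x ⟨
    y ∙ y ^ k ∙ x    ∎

  record Order (x : Fin n) (d : ℕ) : Set where
    field
      positive : 0 < d
      ^-order  : x ^ d ≡ ε
      minimal  : ∀ {k} → 0 < k → k < d → x ^ k ≢ ε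

  finite-order : ∀ x → ∃ λ (t : Fin n) → x ^ suc (toℕ t) ≡ ε
  finite-order x with pigeonhole (n<1+n n) (λ (i : Fin (suc n)) → x ^ toℕ i)
  ... | i , j , i<j , xⁱ≡xʲ with m≤n⇒∃[o]m+o≡n i<j
  ... | k , i+1+k≡j =
    fromℕ< k<n , subst (λ m → x ^ suc m ≡ ε) (sym (toℕ-fromℕ< k<n)) (^-cancel x (toℕ i) (suc k) xⁱ≡xⁱ⁺ᵏ⁺¹)
    where
    xⁱ≡xⁱ⁺ᵏ⁺¹ : x ^ toℕ i ≡ x ^ (toℕ i + suc k)
    xⁱ≡xⁱ⁺ᵏ⁺¹ = trans xⁱ≡xʲ (cong (x ^_) (trans (sym i+1+k≡j) (sym (+-suc _ k))))

    k<n : k < n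
    k<n = ≤-trans (s≤s (m≤n+m k (toℕ i))) (subst (_≤ n) (sym i+1+k≡j) (s≤s⁻¹ (toℕ<n j)))

  order : ∀ x → ∃ (Order x)
  order x with ¬∀⟶∃¬-smallest n (λ t → x ^ suc (toℕ t) ≢ ε) (λ t → ¬? (x ^ suc (toℕ t) ≟ ε))
                               (λ never → never (proj₁ (finite-order x)) (proj₂ (finite-order x)))
  ... | t , ¬xᵗ⁺¹≢ε , smaller = suc (toℕ t) , record
    { positive = z<s
    ; ^-order  = decidable-stable (x ^ suc (toℕ t) ≟ ε) ¬xᵗ⁺¹≢ε
    ; minimal  = λ { {suc k} _ k<t →
        subst (λ m → x ^ suc m ≢ ε) (trans (toℕ-inject _) (toℕ-fromℕ< (s<s⁻¹ k<t))) (smaller (fromℕ< (s<s⁻¹ k<t))) }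
    }

  module _ {x d} (o : Order x d) where
    open Order o
    private instance
      d≢0 : NonZero d
      d≢0 = >-nonZero positive

    private
      no-collision : ∀ {i j} → i < j → j < d → x ^ i ≢ x ^ j
      no-collision {i} {j} i<j j<d xⁱ≡xʲ with m≤n⇒∃[o]m+o≡n i<j
      ... | k , i+1+k≡j = minimal z<s (≤-<-trans (subst (suc k ≤_) i+1+k≡j (s≤s (m≤n+m k i))) j<d)
        (^-cancel x i (suc k) (trans xⁱ≡xʲ (cong (x ^_) (trans (sym i+1+k≡j) (sym (+-suc i k))))))

    ^-injective : ∀ {i j} → i < d → j < d → x ^ i ≡ x ^ j → i ≡ j
    ^-injective {i} {j} i<d j<d xⁱ≡xʲ with <-cmp i j
    ... | tri< i<j _ _ = ⊥-elim (no-collision i<j j<d xⁱ≡xʲ)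
    ... | tri≈ _ i≡j _ = i≡j
    ... | tri> _ _ j<i = ⊥-elim (no-collision j<i i<d (sym xⁱ≡xʲ))

    ^-≡⇒%-≡ : ∀ {i j} → x ^ i ≡ x ^ j → i % d ≡ j % d
    ^-≡⇒%-≡ {i} {j} xⁱ≡xʲ =
      ^-injective (m%n<n i d) (m%n<n j d) (trans (sym (^-% ^-order i)) (trans xⁱ≡xʲ (^-% ^-order j)))

    ^≡ε⇒∣ : ∀ {k} → x ^ k ≡ ε → d ∣ k
    ^≡ε⇒∣ {k} xᵏ≡ε = m%n≡0⇒n∣m k d (trans (^-≡⇒%-≡ {k} {0} xᵏ≡ε) (m<n⇒m%n≡m positive))

    Orbit : Fin n → Pred (Fin n) 0ℓ
    Orbit y z = ∃ λ (i : Fin d) → x ^ toℕ i ∙ y ≡ z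

    orbit? : ∀ y → Decidable (Orbit y)
    orbit? y z = any? (λ i → x ^ toℕ i ∙ y ≟ z)

    count-orbit : ∀ y → count (orbit? y) ≡ d
    count-orbit y = count-image (λ i → x ^ toℕ i ∙ y)
      (λ eq → toℕ-injective (^-injective (toℕ<n _) (toℕ<n _) (∙-cancelʳ y _ _ eq)))

    orbit-pred : ∀ {y z} → Orbit y (x ∙ z) → Orbit y z
    orbit-pred {y} {z} (i , xⁱy≡xz) = (d ∸ 1 + toℕ i) mod d , (begin
      x ^ toℕ ((d ∸ 1 + toℕ i) mod d) ∙ y  ≡⟨ cong (λ k → x ^ k ∙ y) (toℕ-fromℕ< (m%n<n (d ∸ 1 + toℕ i) d)) ⟩
      x ^ ((d ∸ 1 + toℕ i) % d) ∙ y        ≡⟨ cong (_∙ y) (^-% ^-order (d ∸ 1 + toℕ i)) ⟨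
      x ^ (d ∸ 1 + toℕ i) ∙ y              ≡⟨ cong (_∙ y) (^-+ x (d ∸ 1) (toℕ i)) ⟩
      x ^ (d ∸ 1) ∙ x ^ toℕ i ∙ y          ≡⟨ assoc _ _ _ ⟩
      x ^ (d ∸ 1) ∙ (x ^ toℕ i ∙ y)        ≡⟨ cong (x ^ (d ∸ 1) ∙_) xⁱy≡xz ⟩
      x ^ (d ∸ 1) ∙ (x ∙ z)                ≡⟨ assoc _ _ _ ⟨
      x ^ (d ∸ 1) ∙ x ∙ z                  ≡⟨ cong (_∙ z) (^-suc x (d ∸ 1)) ⟨
      x ^ suc (d ∸ 1) ∙ z                  ≡⟨ cong (λ k → x ^ k ∙ z) (suc-pred d) ⟩
      x ^ d ∙ z                            ≡⟨ cong (_∙ z) ^-order ⟩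
      ε ∙ z                                ≡⟨ identityˡ z ⟩
      z                                    ∎)

    Invariant : Pred (Fin n) 0ℓ → Set
    Invariant P = ∀ {z} → P z → P (x ∙ z)

    orbit⊆ : ∀ {P} → Invariant P → ∀ {y} → P y → ∀ {z} → Orbit y z → P z
    orbit⊆ {P} invariant {y} Py (i , xⁱy≡z) = subst P xⁱy≡z (go (toℕ i))
      where
      go : ∀ k → P (x ^ k ∙ y)
      go zero    = subst P (sym (identityˡ y)) Py
      go (suc k) = subst P (sym (assoc x (x ^ k) y)) (invariant (go k))

    -- Induction on the size of P: remove one orbit ⟨x⟩y ⊆ P, of size d, at a time.
    order-∣-count : ∀ fuel {P} (P? : Decidable P) → Invariant P → count P? ≤ fuel → d ∣ count P?
    order-∣-count fuel {P} P? invariant bound with any? P?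
    ... | no ∄P        = subst (d ∣_) (sym (count-∅ P? (λ z Pz → ∄P (z , Pz)))) (d ∣0)
    ... | yes (y , Py) = subst (d ∣_) (sym count≡d+rest) (∣m∣n⇒∣m+n ∣-refl (divides-rest fuel bound))
      where
      rest? : Decidable (P ∩ ∁ (Orbit y))
      rest? = P? ∩? ∁? (orbit? y)

      count≡d+rest : count P? ≡ d + count rest?
      count≡d+rest = trans (count-split P? (orbit? y)) (cong (_+ count rest?) (trans
        (count-cong _ (orbit? y) (λ z → proj₂) (λ z z∈O → orbit⊆ invariant Py z∈O , z∈O)) (count-orbit y)))

      rest-invariant : Invariant (P ∩ ∁ (Orbit y))
      rest-invariant (Pz , z∉O) = invariant Pz , z∉O ∘ orbit-pred

      divides-rest : ∀ fuel → count P? ≤ fuel → d ∣ count rest?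
      divides-rest zero       bound = contradiction
        (<-≤-trans positive (≤-trans (m≤m+n d _) (subst (_≤ 0) count≡d+rest bound))) n≮0
      divides-rest (suc fuel) bound = order-∣-count fuel rest? rest-invariant
        (≤-pred (<-≤-trans (m<n+m _ positive) (subst (_≤ suc fuel) count≡d+rest bound)))

    lagrange : d ∣ n
    lagrange = subst (d ∣_) (count-U U? _) (order-∣-count n U? _ (≤-reflexive (count-U U? _)))
      where
      U? : Decidable (λ (_ : Fin n) → ⊤)
      U? _ = yes tt

  ∣⇒^≡ε : ∀ {x d k} → x ^ d ≡ ε → d ∣ k → x ^ k ≡ ε
  ∣⇒^≡ε {x} {d} xᵈ≡ε (divides q refl) = trans (cong (x ^_) (*-comm q d)) (^-*-ε x d xᵈ≡ε q)

  order-n⇒cyclic : ∀ {x} → Order x n → IsCyclic group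
  order-n⇒cyclic {x} o = x , λ y →
    let i , xⁱ≡y = injective⇒surjective (toℕ-injective ∘ ^-injective o (toℕ<n _) (toℕ<n _)) y
    in + toℕ i , sym (trans (powℕ≡^ (toℕ i)) xⁱ≡y)
    where
    powℕ≡^ : ∀ k → powℕ group x k ≡ x ^ k
    powℕ≡^ zero    = refl
    powℕ≡^ (suc k) = cong (x ∙_) (powℕ≡^ k)

  noncyclic⇒^p^k≡ε : ∀ {p k} → Prime p → n ≡ p ℕ.^ suc k → ¬ IsCyclic group →
                     ∀ x → x ^ (p ℕ.^ k) ≡ ε
  noncyclic⇒^p^k≡ε {p} {k} p-prime n≡p^[1+k] noncyclic x with order x
  ... | d , o with ∣p^[1+k]⇒≡∨∣p^k p-prime k (subst (d ∣_) n≡p^[1+k] (lagrange o))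
  ...   | inj₁ d≡p^[1+k] =
    contradiction (order-n⇒cyclic (subst (Order x) (trans d≡p^[1+k] (sym n≡p^[1+k])) o)) noncyclic
  ...   | inj₂ d∣p^k = ∣⇒^≡ε (Order.^-order o) d∣p^k

  order-p^[1+k] : ∀ {p k x} → Prime p → x ^ (p ℕ.^ suc k) ≡ ε → x ^ (p ℕ.^ k) ≢ ε →
                  Order x (p ℕ.^ suc k)
  order-p^[1+k] {p} {k} {x} p-prime x^p^[1+k]≡ε x^p^k≢ε with order x
  ... | d , o with ∣p^[1+k]⇒≡∨∣p^k p-prime k (^≡ε⇒∣ o x^p^[1+k]≡ε)
  ...   | inj₁ d≡p^[1+k] = subst (Order x) d≡p^[1+k] o
  ...   | inj₂ d∣p^k     = contradiction (∣⇒^≡ε (Order.^-order o) d∣p^k) x^p^k≢ε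

  -- Colourings from multiplication tables

  module _ {k} {M : Set} (enumeration : Fin k ↔ M) {_⋆_ : Op₂ M} {e : M} (φ : M → Fin n)
           (φ-homo : ∀ x y → φ (x ⋆ y) ≡ φ x ∙ φ y) (φ-injective : Injective _≡_ _≡_ φ) where
    open MultiplicationTable enumeration _⋆_ e
    open Inverse enumeration using (to; from; strictlyInverseˡ; strictlyInverseʳ)

    private
      ψ : Fin k → Fin n
      ψ = φ ∘ to

      ψ-homo : ∀ u v → ψ (u · v) ≡ ψ u ∙ ψ v
      ψ-homo u v = trans (cong φ (strictlyInverseˡ _)) (φ-homo (to u) (to v))

      ψ-injective : Injective _≡_ _≡_ ψ
      ψ-injective {u} {v} ψu≡ψv =
        trans (sym (strictlyInverseʳ u)) (trans (cong from (φ-injective ψu≡ψv)) (strictlyInverseʳ v))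

    colourable-from-table : k ≡ n → ∀ σ → IsColouringTable σ → Colourable group
    colourable-from-table refl σ (1#·1#≡1# , inverse-left , σ-unique , f₁-unique , f₂-unique , f₃-unique) =
      σ′ , injective⇒bijective (conjugate-injective (unique-tabulate⇒injective f₁-unique) f₁)
         , injective⇒bijective (conjugate-injective (unique-tabulate⇒injective f₂-unique) f₂)
         , injective⇒bijective (conjugate-injective (unique-tabulate⇒injective f₃-unique) f₃)
      where
      ψ⁻¹ : Fin n → Fin n
      ψ⁻¹ y = proj₁ (injective⇒surjective ψ-injective y)

      ψψ⁻¹ : ∀ y → ψ (ψ⁻¹ y) ≡ y
      ψψ⁻¹ y = proj₂ (injective⇒surjective ψ-injective y)

      conjugate-injective : ∀ {f F : Fin n → Fin n} → Injective _≡_ _≡_ f → (∀ y → F y ≡ ψ (f (ψ⁻¹ y))) →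
                            Injective _≡_ _≡_ F
      conjugate-injective f-inj F≡ψfψ⁻¹ {y} {y′} Fy≡Fy′ = begin
        y                ≡⟨ ψψ⁻¹ y ⟨
        ψ (ψ⁻¹ y)        ≡⟨ cong ψ (f-inj (ψ-injective (trans (sym (F≡ψfψ⁻¹ y)) (trans Fy≡Fy′ (F≡ψfψ⁻¹ y′))))) ⟩
        ψ (ψ⁻¹ y′)       ≡⟨ ψψ⁻¹ y′ ⟩
        y′               ∎

      σ′ : Bijection (Group.setoid group) (Group.setoid group)
      σ′ = record
        { to        = ψ ∘ σ ∘ ψ⁻¹
        ; cong      = cong (ψ ∘ σ ∘ ψ⁻¹)
        ; bijective = injective⇒bijective (conjugate-injective (unique-tabulate⇒injective σ-unique) λ _ → refl)
        }

      ψ1#≡ε : ψ 1# ≡ ε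
      ψ1#≡ε = identityˡ-unique (ψ 1#) (ψ 1#) (trans (sym (ψ-homo 1# 1#)) (cong ψ 1#·1#≡1#))

      ψ-inverse : ∀ u → ψ (inverse u) ≡ ψ u ⁻¹
      ψ-inverse u =
        inverseˡ-unique (ψ (inverse u)) (ψ u) (trans (sym (ψ-homo _ u)) (trans (cong ψ (inverse-left u)) ψ1#≡ε))

      f₁ : ∀ y → ψ (σ (ψ⁻¹ y)) ∙ y ≡ ψ (σ (ψ⁻¹ y) · ψ⁻¹ y)
      f₁ y = trans (cong (ψ (σ (ψ⁻¹ y)) ∙_) (sym (ψψ⁻¹ y))) (sym (ψ-homo _ _))

      f₂ : ∀ y → y ⁻¹ ∙ ψ (σ (ψ⁻¹ y)) ≡ ψ (inverse (ψ⁻¹ y) · σ (ψ⁻¹ y))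
      f₂ y = trans (cong (λ t → t ⁻¹ ∙ ψ (σ (ψ⁻¹ y))) (sym (ψψ⁻¹ y)))
             (trans (cong (_∙ ψ (σ (ψ⁻¹ y))) (sym (ψ-inverse (ψ⁻¹ y)))) (sym (ψ-homo _ _)))

      f₃ : ∀ y → y ⁻¹ ∙ ψ (σ (ψ⁻¹ y)) ∙ y ≡ ψ (inverse (ψ⁻¹ y) · σ (ψ⁻¹ y) · ψ⁻¹ y)
      f₃ y = trans (cong₂ _∙_ (f₂ y) (sym (ψψ⁻¹ y))) (sym (ψ-homo _ _))

  -- Subgroups of index three

  record IsSubgroup (H : Pred (Fin n) 0ℓ) : Set where
    field
      ε∈        : H ε
      ∙-closed  : ∀ {x y} → H x → H y → H (x ∙ y)
      ⁻¹-closed : ∀ {x} → H x → H (x ⁻¹)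

    ^-closed : ∀ {x} → H x → ∀ k → H (x ^ k)
    ^-closed x∈H zero    = ε∈
    ^-closed x∈H (suc k) = ∙-closed x∈H (^-closed x∈H k)

  ^-⁻¹ : ∀ x i → ∃ λ j → (x ^ i) ⁻¹ ≡ x ^ j
  ^-⁻¹ x i with order x
  ... | d , o = i * (d ∸ 1) , sym (inverseʳ-unique (x ^ i) (x ^ (i * (d ∸ 1))) xⁱ∙x⁽ᵈ⁻¹⁾ⁱ≡ε)
    where
    1+[d∸1]≡d : suc (d ∸ 1) ≡ d
    1+[d∸1]≡d = suc-pred d {{>-nonZero (Order.positive o)}}

    xⁱ∙x⁽ᵈ⁻¹⁾ⁱ≡ε : x ^ i ∙ x ^ (i * (d ∸ 1)) ≡ ε
    xⁱ∙x⁽ᵈ⁻¹⁾ⁱ≡ε = begin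
      x ^ i ∙ x ^ (i * (d ∸ 1))  ≡⟨ ^-+ x i (i * (d ∸ 1)) ⟨
      x ^ (i + i * (d ∸ 1))      ≡⟨ cong (x ^_) (trans (sym (*-suc i (d ∸ 1))) (cong (i *_) 1+[d∸1]≡d)) ⟩
      x ^ (i * d)                ≡⟨ ∣⇒^≡ε (Order.^-order o) (n∣m*n i) ⟩
      ε                          ∎

  closed⇒isSubgroup : ∀ {H : Pred (Fin n) 0ℓ} {x₀} → H x₀ → (∀ {x y} → H x → H y → H (x ∙ y)) →
                      IsSubgroup H
  closed⇒isSubgroup {H} {x₀} x₀∈H ∙-closed = record { ε∈ = ε∈ ; ∙-closed = ∙-closed ; ⁻¹-closed = ⁻¹-closed }
    where
    ^-suc-closed : ∀ {x} → H x → ∀ k → H (x ^ suc k)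
    ^-suc-closed x∈H zero    = subst H (sym (identityʳ _)) x∈H
    ^-suc-closed x∈H (suc k) = ∙-closed x∈H (^-suc-closed x∈H k)

    ε∈ : H ε
    ε∈ = let d , o = order x₀ in
      subst H (trans (cong (x₀ ^_) (suc-pred d {{>-nonZero (Order.positive o)}})) (Order.^-order o))
              (^-suc-closed x₀∈H (d ∸ 1))

    ⁻¹-closed : ∀ {x} → H x → H (x ⁻¹)
    ⁻¹-closed {x} x∈H = let j , x¹⁻¹≡xʲ = ^-⁻¹ x 1 in
      subst H (trans (sym x¹⁻¹≡xʲ) (cong _⁻¹ (identityʳ x))) (^-closed j)
      where
      ^-closed : ∀ k → H (x ^ k)
      ^-closed zero    = ε∈
      ^-closed (suc k) = ^-suc-closed x∈H k

  module _ {H : Pred (Fin n) 0ℓ} (H-sub : IsSubgroup H) {b} (b∉H : ¬ H b) (b²∉H : ¬ H (b ^ 2)) where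
    open IsSubgroup H-sub

    private
      shift : ∀ {h h′} i k → H h → H h′ → h ∙ b ^ i ≡ h′ ∙ b ^ (k + i) → H (b ^ k)
      shift {h} {h′} i k h∈H h′∈H eq =
        subst H (sym (y≈x\\z h′ (b ^ k) h (sym h≡h′bᵏ))) (∙-closed (⁻¹-closed h′∈H) h∈H)
        where
        h≡h′bᵏ : h ≡ h′ ∙ b ^ k
        h≡h′bᵏ = ∙-cancelʳ (b ^ i) h (h′ ∙ b ^ k) (begin
          h ∙ b ^ i              ≡⟨ eq ⟩
          h′ ∙ b ^ (k + i)       ≡⟨ cong (h′ ∙_) (^-+ b k i) ⟩
          h′ ∙ (b ^ k ∙ b ^ i)   ≡⟨ assoc h′ (b ^ k) (b ^ i) ⟨
          h′ ∙ b ^ k ∙ b ^ i     ∎)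

      b¹∉H : ¬ H (b ^ 1)
      b¹∉H = b∉H ∘ subst H (identityʳ b)

    coset-injective : ∀ {h h′} {j j′ : Fin 3} → H h → H h′ → h ∙ b ^ toℕ j ≡ h′ ∙ b ^ toℕ j′ → j ≡ j′
    coset-injective {j = zero}          {zero}          _ _ _ = refl
    coset-injective {j = zero}          {suc zero}      h h′ eq = contradiction (shift 0 1 h h′ eq) b¹∉H
    coset-injective {j = zero}          {suc (suc zero)} h h′ eq = contradiction (shift 0 2 h h′ eq) b²∉H
    coset-injective {j = suc zero}      {zero}          h h′ eq = contradiction (shift 0 1 h′ h (sym eq)) b¹∉H
    coset-injective {j = suc zero}      {suc zero}      _ _ _ = refl
    coset-injective {j = suc zero}      {suc (suc zero)} h h′ eq = contradiction (shift 1 1 h h′ eq) b¹∉H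
    coset-injective {j = suc (suc zero)} {zero}          h h′ eq = contradiction (shift 0 2 h′ h (sym eq)) b²∉H
    coset-injective {j = suc (suc zero)} {suc zero}      h h′ eq = contradiction (shift 1 1 h′ h (sym eq)) b¹∉H
    coset-injective {j = suc (suc zero)} {suc (suc zero)} _ _ _ = refl

  module Extension {A : Set} (_⊕_ : Op₂ A) (ι : A → Fin n) (ι-homo : ∀ u v → ι (u ⊕ v) ≡ ι u ∙ ι v)
                   (θ : A → A) (μ : A) {b} (b-conj : ∀ u → b ∙ ι u ≡ ι (θ u) ∙ b) (b³≡ιμ : b ^ 3 ≡ ι μ) where

    φ : A × Fin 3 → Fin n
    φ (u , j) = ι u ∙ b ^ toℕ j

    b^-conj : ∀ j u → b ^ j ∙ ι u ≡ ι (fold u θ j) ∙ b ^ j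
    b^-conj zero    u = trans (identityˡ _) (sym (identityʳ _))
    b^-conj (suc j) u = begin
      b ∙ b ^ j ∙ ι u                 ≡⟨ assoc b (b ^ j) (ι u) ⟩
      b ∙ (b ^ j ∙ ι u)               ≡⟨ cong (b ∙_) (b^-conj j u) ⟩
      b ∙ (ι (fold u θ j) ∙ b ^ j)    ≡⟨ assoc b _ _ ⟨
      b ∙ ι (fold u θ j) ∙ b ^ j      ≡⟨ cong (_∙ b ^ j) (b-conj (fold u θ j)) ⟩
      ι (fold u θ (suc j)) ∙ b ∙ b ^ j ≡⟨ assoc _ b (b ^ j) ⟩
      ι (fold u θ (suc j)) ∙ b ^ suc j ∎

    ι-fold : ∀ w q → ι (fold w (_⊕ μ) q) ≡ ι w ∙ ι μ ^ q
    ι-fold w zero    = sym (identityʳ _)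
    ι-fold w (suc q) = begin
      ι (fold w (_⊕ μ) q ⊕ μ)      ≡⟨ ι-homo _ μ ⟩
      ι (fold w (_⊕ μ) q) ∙ ι μ     ≡⟨ cong (_∙ ι μ) (ι-fold w q) ⟩
      ι w ∙ ι μ ^ q ∙ ι μ            ≡⟨ assoc _ _ _ ⟩
      ι w ∙ (ι μ ^ q ∙ ι μ)          ≡⟨ cong (ι w ∙_) (^-suc (ι μ) q) ⟨
      ι w ∙ ι μ ^ suc q              ∎

    b^-divMod : ∀ k → b ^ k ≡ ι μ ^ (k / 3) ∙ b ^ (k % 3)
    b^-divMod k = begin
      b ^ k                         ≡⟨ cong (b ^_) (trans (m≡m%n+[m/n]*n k 3) (+-comm (k % 3) _)) ⟩
      b ^ (k / 3 * 3 + k % 3)       ≡⟨ ^-+ b (k / 3 * 3) (k % 3) ⟩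
      b ^ (k / 3 * 3) ∙ b ^ (k % 3) ≡⟨ cong (λ t → b ^ t ∙ b ^ (k % 3)) (*-comm (k / 3) 3) ⟩
      b ^ (3 * (k / 3)) ∙ b ^ (k % 3) ≡⟨ cong (_∙ b ^ (k % 3)) (trans (^-* b 3 (k / 3)) (cong (_^ (k / 3)) b³≡ιμ)) ⟩
      ι μ ^ (k / 3) ∙ b ^ (k % 3)   ∎

    φ-homo : ∀ x y → φ (extension _⊕_ θ μ x y) ≡ φ x ∙ φ y
    φ-homo (u , j) (v , j′) = sym (begin
      ι u ∙ b ^ J ∙ (ι v ∙ b ^ J′)           ≡⟨ assoc _ (ι v) (b ^ J′) ⟨
      ι u ∙ b ^ J ∙ ι v ∙ b ^ J′             ≡⟨ cong (_∙ b ^ J′) (assoc (ι u) (b ^ J) (ι v)) ⟩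
      ι u ∙ (b ^ J ∙ ι v) ∙ b ^ J′           ≡⟨ cong (λ t → ι u ∙ t ∙ b ^ J′) (b^-conj J v) ⟩
      ι u ∙ (ι (fold v θ J) ∙ b ^ J) ∙ b ^ J′ ≡⟨ cong (_∙ b ^ J′) (assoc (ι u) _ (b ^ J)) ⟨
      ι u ∙ ι (fold v θ J) ∙ b ^ J ∙ b ^ J′   ≡⟨ cong (λ t → t ∙ b ^ J ∙ b ^ J′) (ι-homo u (fold v θ J)) ⟨
      ι w ∙ b ^ J ∙ b ^ J′                   ≡⟨ assoc (ι w) (b ^ J) (b ^ J′) ⟩
      ι w ∙ (b ^ J ∙ b ^ J′)                 ≡⟨ cong (ι w ∙_) (trans (sym (^-+ b J J′)) (b^-divMod (J + J′))) ⟩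
      ι w ∙ (ι μ ^ q ∙ b ^ ((J + J′) % 3))   ≡⟨ assoc (ι w) _ _ ⟨
      ι w ∙ ι μ ^ q ∙ b ^ ((J + J′) % 3)     ≡⟨ cong₂ _∙_ (ι-fold w q) (cong (b ^_) (toℕ-fromℕ< (m%n<n (J + J′) 3))) ⟨
      ι (fold w (_⊕ μ) q) ∙ b ^ toℕ ((J + J′) mod 3) ∎)
      where
      J J′ q : ℕ
      J = toℕ j
      J′ = toℕ j′
      q = (J + J′) / 3

      w : A
      w = u ⊕ fold v θ J

    module _ (ι-injective : Injective _≡_ _≡_ ι) (b∉ι : ∀ u → ι u ≢ b) where
      private
        Image : Pred (Fin n) 0ℓ
        Image y = ∃ λ u → ι u ≡ y

        image-isSubgroup : IsSubgroup Image
        image-isSubgroup = closed⇒isSubgroup (μ , refl) λ { (u , refl) (v , refl) → u ⊕ v , ι-homo u v }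
        open IsSubgroup image-isSubgroup

        b∉Image : ¬ Image b
        b∉Image (u , ιu≡b) = b∉ι u ιu≡b

        b²∉Image : ¬ Image (b ^ 2)
        b²∉Image b²∈Image = b∉Image (subst Image b¹≡b²⁻¹b³ (∙-closed (⁻¹-closed b²∈Image) (μ , sym b³≡ιμ)))
          where
          b¹≡b²⁻¹b³ : (b ^ 2) ⁻¹ ∙ b ^ 3 ≡ b
          b¹≡b²⁻¹b³ = trans (sym (y≈x\\z (b ^ 2) (b ^ 1) (b ^ 3) (sym (^-+ b 2 1)))) (identityʳ b)

      φ-injective : Injective _≡_ _≡_ φ
      φ-injective {u , j} {v , j′} eq = cong₂ _,_ (ι-injective (∙-cancelʳ (b ^ toℕ j) (ι u) (ι v) eq′)) j≡j′
        where
        j≡j′ : j ≡ j′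
        j≡j′ = coset-injective image-isSubgroup b∉Image b²∉Image (u , refl) (v , refl) eq

        eq′ : ι u ∙ b ^ toℕ j ≡ ι v ∙ b ^ toℕ j
        eq′ = trans eq (cong (λ t → ι v ∙ b ^ toℕ t) (sym j≡j′))

  module IndexThree {p h} .{{_ : NonZero p}} (n≡p*3 : n ≡ p * 3) (p≡1+2h : p ≡ suc (2 * h)) {a} (a-order : Order a p)
                    {b} (b^p≡ε : b ^ p ≡ ε) (b∉⟨a⟩ : ∀ (i : Fin p) → a ^ toℕ i ≢ b) where

    ⟨a⟩ : Pred (Fin n) 0ℓ
    ⟨a⟩ y = ∃ λ (i : Fin p) → a ^ toℕ i ≡ y

    a^∈⟨a⟩ : ∀ k → ⟨a⟩ (a ^ k)
    a^∈⟨a⟩ k = k mod p , ^-mod (Order.^-order a-order) k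

    ⟨a⟩-isSubgroup : IsSubgroup ⟨a⟩
    ⟨a⟩-isSubgroup = closed⇒isSubgroup (a^∈⟨a⟩ 0)
      λ { (i , refl) (j , refl) → subst ⟨a⟩ (^-+ a (toℕ i) (toℕ j)) (a^∈⟨a⟩ (toℕ i + toℕ j)) }
    open IsSubgroup ⟨a⟩-isSubgroup

    private
      b∉ : ¬ ⟨a⟩ b
      b∉ (i , aⁱ≡b) = b∉⟨a⟩ i aⁱ≡b

      b²∉ : ¬ ⟨a⟩ (b ^ 2)
      b²∉ b²∈ = b∉ (subst ⟨a⟩ b²⁽¹⁺ʰ⁾≡b (^-closed b²∈ (suc h)))
        where
        b²⁽¹⁺ʰ⁾≡b : (b ^ 2) ^ suc h ≡ b
        b²⁽¹⁺ʰ⁾≡b = begin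
          (b ^ 2) ^ suc h  ≡⟨ ^-* b 2 (suc h) ⟨
          b ^ (2 * suc h)  ≡⟨ cong (b ^_) (trans (*-suc 2 h) (cong suc (sym p≡1+2h))) ⟩
          b ∙ b ^ p        ≡⟨ cong (b ∙_) b^p≡ε ⟩
          b ∙ ε            ≡⟨ identityʳ b ⟩
          b                ∎

      φ : Fin p × Fin 3 → Fin n
      φ (i , j) = a ^ toℕ i ∙ b ^ toℕ j

      φ-injective : Injective _≡_ _≡_ φ
      φ-injective {i , j} {i′ , j′} eq =
        cong₂ _,_ (toℕ-injective (^-injective a-order (toℕ<n i) (toℕ<n i′) (∙-cancelʳ _ _ _ eq′))) j≡j′
        where
        j≡j′ : j ≡ j′
        j≡j′ = coset-injective ⟨a⟩-isSubgroup b∉ b²∉ (i , refl) (i′ , refl) eq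

        eq′ : a ^ toℕ i ∙ b ^ toℕ j ≡ a ^ toℕ i′ ∙ b ^ toℕ j
        eq′ = trans eq (cong (λ t → a ^ toℕ i′ ∙ b ^ toℕ t) (sym j≡j′))

      decompose : ∀ y → ∃ λ ij → φ ij ≡ y
      decompose y = let k , φk≡y = injective⇒surjective′ (sym n≡p*3) φ′-injective y in remQuot 3 k , φk≡y
        where
        φ′-injective : Injective _≡_ _≡_ (φ ∘ remQuot {p} 3)
        φ′-injective {k} {k′} eq = trans (sym (combine-remQuot {p} 3 k))
          (trans (cong (uncurry combine) (φ-injective {remQuot 3 k} {remQuot 3 k′} eq)) (combine-remQuot {p} 3 k′))

    part : Fin n → Fin p
    part y = proj₁ (proj₁ (decompose y))

    coset : Fin n → Fin 3
    coset y = proj₂ (proj₁ (decompose y))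

    decompose-≡ : ∀ y → a ^ toℕ (part y) ∙ b ^ toℕ (coset y) ≡ y
    decompose-≡ y = proj₂ (decompose y)

    coset-unique : ∀ {h j y} → ⟨a⟩ h → h ∙ b ^ toℕ j ≡ y → coset y ≡ j
    coset-unique {y = y} h∈ eq =
      coset-injective ⟨a⟩-isSubgroup b∉ b²∉ (part y , refl) h∈ (trans (decompose-≡ y) (sym eq))

    coset-∙ˡ : ∀ {h} → ⟨a⟩ h → ∀ y → coset (h ∙ y) ≡ coset y
    coset-∙ˡ {h} h∈ y = coset-unique (∙-closed h∈ (part y , refl))
      (trans (assoc h _ _) (cong (h ∙_) (decompose-≡ y)))

    -- The right action of G on the three cosets ⟨a⟩, ⟨a⟩b, ⟨a⟩b².
    act : Fin n → Fin 3 → Fin 3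
    act g j = coset (b ^ toℕ j ∙ g)

    act-∙ : ∀ g g′ j → act (g ∙ g′) j ≡ act g′ (act g j)
    act-∙ g g′ j = begin
      coset (b ^ toℕ j ∙ (g ∙ g′))                              ≡⟨ cong coset (assoc _ g g′) ⟨
      coset (b ^ toℕ j ∙ g ∙ g′)                                ≡⟨ cong (λ t → coset (t ∙ g′)) (decompose-≡ _) ⟨
      coset (a ^ toℕ (part _) ∙ b ^ toℕ (act g j) ∙ g′)          ≡⟨ cong coset (assoc _ _ g′) ⟩
      coset (a ^ toℕ (part _) ∙ (b ^ toℕ (act g j) ∙ g′))        ≡⟨ coset-∙ˡ (part (b ^ toℕ j ∙ g) , refl) _ ⟩
      act g′ (act g j)                                          ∎

    act-ε : ∀ j → act ε j ≡ j
    act-ε j = coset-unique ε∈ (trans (identityˡ _) (sym (identityʳ _)))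

    act-injective : ∀ g {j j′} → act g j ≡ act g j′ → j ≡ j′
    act-injective g {j} {j′} eq = begin
      j                      ≡⟨ act-ε j ⟨
      act ε j                ≡⟨ cong (λ t → act t j) (inverseʳ g) ⟨
      act (g ∙ g ⁻¹) j       ≡⟨ act-∙ g (g ⁻¹) j ⟩
      act (g ⁻¹) (act g j)   ≡⟨ cong (act (g ⁻¹)) eq ⟩
      act (g ⁻¹) (act g j′)  ≡⟨ act-∙ g (g ⁻¹) j′ ⟨
      act (g ∙ g ⁻¹) j′      ≡⟨ cong (λ t → act t j′) (inverseʳ g) ⟩
      act ε j′               ≡⟨ act-ε j′ ⟩
      j′                     ∎

    act-^ : ∀ g k j → act (g ^ k) j ≡ iterate (act g) j k
    act-^ g zero    j = act-ε j
    act-^ g (suc k) j = trans (act-∙ g (g ^ k) j) (act-^ g k (act g j))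

    act-⟨a⟩ : ∀ {h} → ⟨a⟩ h → act h 0F ≡ 0F
    act-⟨a⟩ h∈ = coset-unique h∈ (trans (identityʳ _) (sym (identityˡ _)))

    -- a fixes the coset ⟨a⟩ and has odd order, so it cannot swap the other two cosets.
    b∙a∈⟨a⟩b : ∃ λ (r : Fin p) → b ∙ a ≡ a ^ toℕ r ∙ b
    b∙a∈⟨a⟩b = part (b ∙ a) , (begin
      b ∙ a                                               ≡⟨ decompose-≡ (b ∙ a) ⟨
      a ^ toℕ (part (b ∙ a)) ∙ b ^ toℕ (coset (b ∙ a))    ≡⟨ cong (λ j → a ^ toℕ (part (b ∙ a)) ∙ b ^ toℕ j) coset-b∙a ⟩
      a ^ toℕ (part (b ∙ a)) ∙ (b ∙ ε)                    ≡⟨ cong (a ^ toℕ (part (b ∙ a)) ∙_) (identityʳ b) ⟩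
      a ^ toℕ (part (b ∙ a)) ∙ b                          ∎)
      where
      a∈ : ⟨a⟩ a
      a∈ = subst ⟨a⟩ (identityʳ a) (a^∈⟨a⟩ 1)

      aᵖ-fixes-1F : iterate (act a) 1F (suc (2 * h)) ≡ 1F
      aᵖ-fixes-1F = begin
        iterate (act a) 1F (suc (2 * h))  ≡⟨ act-^ a (suc (2 * h)) 1F ⟨
        act (a ^ suc (2 * h)) 1F          ≡⟨ cong (λ k → act (a ^ k) 1F) p≡1+2h ⟨
        act (a ^ p) 1F                    ≡⟨ cong (λ t → act t 1F) (Order.^-order a-order) ⟩
        act ε 1F                          ≡⟨ act-ε 1F ⟩
        1F                                ∎

      coset-b∙a : coset (b ∙ a) ≡ 1F
      coset-b∙a = trans (cong (λ t → coset (t ∙ a)) (sym (identityʳ b)))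
                        (odd-iterate-fixes-1F (act-injective a) (act-⟨a⟩ a∈) h aᵖ-fixes-1F)

    b³∈⟨a⟩ : ∃ λ (m : Fin p) → b ^ 3 ≡ a ^ toℕ m
    b³∈⟨a⟩ = part (b ^ 3) , (begin
      b ^ 3                                                ≡⟨ decompose-≡ (b ^ 3) ⟨
      a ^ toℕ (part (b ^ 3)) ∙ b ^ toℕ (coset (b ^ 3))     ≡⟨ cong (λ j → a ^ toℕ (part (b ^ 3)) ∙ b ^ toℕ j) coset-b³ ⟩
      a ^ toℕ (part (b ^ 3)) ∙ ε                           ≡⟨ identityʳ _ ⟩
      a ^ toℕ (part (b ^ 3))                               ∎)
      where
      act-b-0F : act b 0F ≡ 1F
      act-b-0F = coset-unique ε∈ (cong (ε ∙_) (identityʳ b))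

      act-b-1F : act b 1F ≡ 2F
      act-b-1F = coset-unique ε∈ (begin
        ε ∙ b ^ 2        ≡⟨ identityˡ _ ⟩
        b ∙ (b ∙ ε)      ≡⟨ cong (b ∙_) (identityʳ b) ⟩
        b ∙ b            ≡⟨ cong (_∙ b) (identityʳ b) ⟨
        b ∙ ε ∙ b        ∎)

      coset-b³ : coset (b ^ 3) ≡ 0F
      coset-b³ = trans (cong coset (^-suc b 2)) (third-value (act-injective b) act-b-0F act-b-1F)

  module Metacyclic {p} .{{_ : NonZero p}} {a} (a-order : Order a p) {b} (r m : Fin p)
                    (b∙a≡aʳ∙b : b ∙ a ≡ a ^ toℕ r ∙ b) (b³≡aᵐ : b ^ 3 ≡ a ^ toℕ m) where
    private
      R M : ℕ
      R = toℕ r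
      M = toℕ m

    b∙aⁱ : ∀ i → b ∙ a ^ i ≡ a ^ (R * i) ∙ b
    b∙aⁱ zero    = trans (identityʳ b) (trans (sym (identityˡ b)) (cong (λ k → a ^ k ∙ b) (sym (*-zeroʳ R))))
    b∙aⁱ (suc i) = begin
      b ∙ (a ∙ a ^ i)            ≡⟨ assoc b a (a ^ i) ⟨
      b ∙ a ∙ a ^ i              ≡⟨ cong (_∙ a ^ i) b∙a≡aʳ∙b ⟩
      a ^ R ∙ b ∙ a ^ i          ≡⟨ assoc _ b _ ⟩
      a ^ R ∙ (b ∙ a ^ i)        ≡⟨ cong (a ^ R ∙_) (b∙aⁱ i) ⟩
      a ^ R ∙ (a ^ (R * i) ∙ b)  ≡⟨ assoc _ _ b ⟨
      a ^ R ∙ a ^ (R * i) ∙ b    ≡⟨ cong (_∙ b) (^-+ a R (R * i)) ⟨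
      a ^ (R + R * i) ∙ b        ≡⟨ cong (λ k → a ^ k ∙ b) (*-suc R i) ⟨
      a ^ (R * suc i) ∙ b        ∎

    bʲ∙aⁱ : ∀ j i → b ^ j ∙ a ^ i ≡ a ^ (R ℕ.^ j * i) ∙ b ^ j
    bʲ∙aⁱ zero    i = trans (identityˡ _) (trans (cong (a ^_) (sym (*-identityˡ i))) (sym (identityʳ _)))
    bʲ∙aⁱ (suc j) i = begin
      b ∙ b ^ j ∙ a ^ i                    ≡⟨ assoc b _ _ ⟩
      b ∙ (b ^ j ∙ a ^ i)                  ≡⟨ cong (b ∙_) (bʲ∙aⁱ j i) ⟩
      b ∙ (a ^ (R ℕ.^ j * i) ∙ b ^ j)      ≡⟨ assoc b _ _ ⟨
      b ∙ a ^ (R ℕ.^ j * i) ∙ b ^ j        ≡⟨ cong (_∙ b ^ j) (b∙aⁱ _) ⟩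
      a ^ (R * (R ℕ.^ j * i)) ∙ b ∙ b ^ j  ≡⟨ assoc _ b _ ⟩
      a ^ (R * (R ℕ.^ j * i)) ∙ b ^ suc j  ≡⟨ cong (λ k → a ^ k ∙ b ^ suc j) (*-assoc R (R ℕ.^ j) i) ⟨
      a ^ (R ℕ.^ suc j * i) ∙ b ^ suc j    ∎

    -- b³ ∈ ⟨a⟩ commutes with a, while conjugating a by b³ raises it to the power r³.
    r³≡1 : (R ℕ.^ 3) % p ≡ 1 % p
    r³≡1 = sym (^-≡⇒%-≡ a-order (∙-cancelʳ (a ^ M) (a ^ 1) (a ^ (R ℕ.^ 3)) (begin
      a ^ 1 ∙ a ^ M               ≡⟨ ^-+ a 1 M ⟨
      a ^ (1 + M)                 ≡⟨ cong (a ^_) (+-comm 1 M) ⟩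
      a ^ (M + 1)                 ≡⟨ ^-+ a M 1 ⟩
      a ^ M ∙ a ^ 1               ≡⟨ cong (_∙ a ^ 1) b³≡aᵐ ⟨
      b ^ 3 ∙ a ^ 1               ≡⟨ bʲ∙aⁱ 3 1 ⟩
      a ^ (R ℕ.^ 3 * 1) ∙ b ^ 3   ≡⟨ cong₂ (λ k t → a ^ k ∙ t) (*-identityʳ (R ℕ.^ 3)) b³≡aᵐ ⟩
      a ^ (R ℕ.^ 3) ∙ a ^ M       ∎)))

    mq≡0 : ∀ {q} → p ≡ 3 * q → b ^ p ≡ ε → (M * q) % p ≡ 0
    mq≡0 {q} p≡3q bᵖ≡ε = n∣m⇒m%n≡0 (M * q) p (^≡ε⇒∣ a-order (begin
      a ^ (M * q)  ≡⟨ ^-* a M q ⟩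
      (a ^ M) ^ q  ≡⟨ cong (_^ q) b³≡aᵐ ⟨
      (b ^ 3) ^ q  ≡⟨ ^-* b 3 q ⟨
      b ^ (3 * q)  ≡⟨ cong (b ^_) p≡3q ⟨
      b ^ p        ≡⟨ bᵖ≡ε ⟩
      ε            ∎))

    private
      module E = Extension (addMod p) (λ i → a ^ toℕ i)
        (λ i j → trans (^-mod (Order.^-order a-order) (toℕ i + toℕ j)) (^-+ a (toℕ i) (toℕ j)))
        (λ i → (R * toℕ i) mod p) m
        (λ i → trans (b∙aⁱ (toℕ i)) (cong (_∙ b) (sym (^-mod (Order.^-order a-order) (R * toℕ i)))))
        b³≡aᵐ
    open E public using (φ; φ-homo)

    φ-injective : (∀ (i : Fin p) → a ^ toℕ i ≢ b) → Injective _≡_ _≡_ φ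
    φ-injective = E.φ-injective (toℕ-injective ∘ ^-injective a-order (toℕ<n _) (toℕ<n _))

  module _ {p q h} .{{_ : NonZero p}} (n≡p*3 : n ≡ p * 3) (p≡3q : p ≡ 3 * q) (p≡1+2h : p ≡ suc (2 * h))
           (exponent-p : ∀ x → x ^ p ≡ ε) {a} (a-order : Order a p) {e : Fin p × Fin 3} where

    metacyclic-colourable : (σ : Fin p → Fin p → Fin (p * 3) → Fin (p * 3)) →
      (∀ (r m : Fin p) → (toℕ r ℕ.^ 3) % p ≡ 1 % p → (toℕ m * q) % p ≡ 0 →
         MultiplicationTable.IsColouringTable *↔× (metacyclic p r m) e (σ r m)) →
      Colourable group
    metacyclic-colourable σ tables = with-b (outside (λ (i : Fin p) → a ^ toℕ i) p<n)
      where
      p<n : p < n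
      p<n = subst (p <_) (sym n≡p*3) (m<m*n p 3 (s≤s (s≤s z≤n)))

      with-b : ∃ (λ b → ∀ (i : Fin p) → a ^ toℕ i ≢ b) → Colourable group
      with-b (b , b∉⟨a⟩) = with-relations b∙a∈⟨a⟩b b³∈⟨a⟩
        where
        open IndexThree {h = h} n≡p*3 p≡1+2h a-order (exponent-p b) b∉⟨a⟩ using (b∙a∈⟨a⟩b; b³∈⟨a⟩)

        with-relations : ∃ (λ r → b ∙ a ≡ a ^ toℕ r ∙ b) → ∃ (λ m → b ^ 3 ≡ a ^ toℕ m) → Colourable group
        with-relations (r , b∙a≡aʳ∙b) (m , b³≡aᵐ) =
          colourable-from-table (*↔× {p} {3}) {metacyclic p r m} {e} φ φ-homo (φ-injective b∉⟨a⟩) (sym n≡p*3)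
            (σ r m) (tables r m r³≡1 (mq≡0 p≡3q (exponent-p b)))
          where open Metacyclic a-order r m b∙a≡aʳ∙b b³≡aᵐ

  -- Groups of exponent three

  commute-⁻¹ : ∀ {x y} → x ∙ y ≡ y ∙ x → x ⁻¹ ∙ y ≡ y ∙ x ⁻¹
  commute-⁻¹ {x} {y} xy≡yx = begin
    x ⁻¹ ∙ y                 ≡⟨ identityʳ _ ⟨
    x ⁻¹ ∙ y ∙ ε             ≡⟨ cong (x ⁻¹ ∙ y ∙_) (inverseʳ x) ⟨
    x ⁻¹ ∙ y ∙ (x ∙ x ⁻¹)    ≡⟨ assoc _ x (x ⁻¹) ⟨
    x ⁻¹ ∙ y ∙ x ∙ x ⁻¹      ≡⟨ cong (_∙ x ⁻¹) (assoc (x ⁻¹) y x) ⟩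
    x ⁻¹ ∙ (y ∙ x) ∙ x ⁻¹    ≡⟨ cong (λ t → x ⁻¹ ∙ t ∙ x ⁻¹) xy≡yx ⟨
    x ⁻¹ ∙ (x ∙ y) ∙ x ⁻¹    ≡⟨ cong (_∙ x ⁻¹) (assoc (x ⁻¹) x y) ⟨
    x ⁻¹ ∙ x ∙ y ∙ x ⁻¹      ≡⟨ cong (λ t → t ∙ y ∙ x ⁻¹) (inverseˡ x) ⟩
    ε ∙ y ∙ x ⁻¹             ≡⟨ cong (_∙ x ⁻¹) (identityˡ y) ⟩
    y ∙ x ⁻¹                 ∎

  commutator : Op₂ (Fin n)
  commutator x y = x ⁻¹ ∙ y ⁻¹ ∙ x ∙ y

  ∙-commutator : ∀ x y → y ∙ x ≡ x ∙ y ∙ commutator y x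
  ∙-commutator x y = sym (begin
    x ∙ y ∙ (y ⁻¹ ∙ x ⁻¹ ∙ y ∙ x)      ≡⟨ cong (x ∙ y ∙_) (trans (assoc _ y x) (assoc (y ⁻¹) (x ⁻¹) (y ∙ x))) ⟩
    x ∙ y ∙ (y ⁻¹ ∙ (x ⁻¹ ∙ (y ∙ x)))  ≡⟨ assoc x y _ ⟩
    x ∙ (y ∙ (y ⁻¹ ∙ (x ⁻¹ ∙ (y ∙ x)))) ≡⟨ cong (x ∙_) (assoc y (y ⁻¹) _) ⟨
    x ∙ (y ∙ y ⁻¹ ∙ (x ⁻¹ ∙ (y ∙ x)))  ≡⟨ cong (λ t → x ∙ (t ∙ (x ⁻¹ ∙ (y ∙ x)))) (inverseʳ y) ⟩
    x ∙ (ε ∙ (x ⁻¹ ∙ (y ∙ x)))         ≡⟨ cong (x ∙_) (identityˡ _) ⟩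
    x ∙ (x ⁻¹ ∙ (y ∙ x))               ≡⟨ assoc x (x ⁻¹) _ ⟨
    x ∙ x ⁻¹ ∙ (y ∙ x)                 ≡⟨ cong (_∙ (y ∙ x)) (inverseʳ x) ⟩
    ε ∙ (y ∙ x)                        ≡⟨ identityˡ _ ⟩
    y ∙ x                              ∎)

  module ExponentThree (exponent-3 : ∀ x → x ^ 3 ≡ ε) where
    x∙x≡x⁻¹ : ∀ x → x ∙ x ≡ x ⁻¹
    x∙x≡x⁻¹ x = inverseʳ-unique x (x ∙ x) (trans (cong (λ t → x ∙ (x ∙ t)) (sym (identityʳ x))) (exponent-3 x))

    x∙y∙x : ∀ x y → x ∙ y ∙ x ≡ y ⁻¹ ∙ x ⁻¹ ∙ y ⁻¹
    x∙y∙x x y = trans (inverseˡ-unique (x ∙ y ∙ x) (y ∙ x ∙ y) (begin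
      x ∙ y ∙ x ∙ (y ∙ x ∙ y)      ≡⟨ assoc (x ∙ y) x _ ⟩
      x ∙ y ∙ (x ∙ (y ∙ x ∙ y))    ≡⟨ cong (λ t → x ∙ y ∙ (x ∙ t)) (assoc y x y) ⟩
      x ∙ y ∙ (x ∙ (y ∙ (x ∙ y)))  ≡⟨ cong (x ∙ y ∙_) (assoc x y (x ∙ y)) ⟨
      x ∙ y ∙ (x ∙ y ∙ (x ∙ y))    ≡⟨ cong (λ t → x ∙ y ∙ (x ∙ y ∙ t)) (identityʳ (x ∙ y)) ⟨
      (x ∙ y) ^ 3                  ≡⟨ exponent-3 (x ∙ y) ⟩
      ε                            ∎))
      (begin
      (y ∙ x ∙ y) ⁻¹              ≡⟨ ⁻¹-anti-homo-∙ (y ∙ x) y ⟩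
      y ⁻¹ ∙ (y ∙ x) ⁻¹           ≡⟨ cong (y ⁻¹ ∙_) (⁻¹-anti-homo-∙ y x) ⟩
      y ⁻¹ ∙ (x ⁻¹ ∙ y ⁻¹)        ≡⟨ assoc (y ⁻¹) (x ⁻¹) (y ⁻¹) ⟨
      y ⁻¹ ∙ x ⁻¹ ∙ y ⁻¹          ∎)

    conjugate-commutes : ∀ x y → x ∙ (y ⁻¹ ∙ x ∙ y) ≡ y ⁻¹ ∙ x ∙ y ∙ x
    conjugate-commutes x y = trans lhs (sym rhs)
      where
      lhs : x ∙ (y ⁻¹ ∙ x ∙ y) ≡ y ∙ x ⁻¹ ∙ y ⁻¹
      lhs = begin
        x ∙ (y ⁻¹ ∙ x ∙ y)                ≡⟨ assoc x _ y ⟨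
        x ∙ (y ⁻¹ ∙ x) ∙ y                ≡⟨ cong (_∙ y) (assoc x (y ⁻¹) x) ⟨
        x ∙ y ⁻¹ ∙ x ∙ y                  ≡⟨ cong (_∙ y) (x∙y∙x x (y ⁻¹)) ⟩
        y ⁻¹ ⁻¹ ∙ x ⁻¹ ∙ y ⁻¹ ⁻¹ ∙ y      ≡⟨ cong (λ t → t ∙ x ⁻¹ ∙ t ∙ y) (⁻¹-involutive y) ⟩
        y ∙ x ⁻¹ ∙ y ∙ y                  ≡⟨ assoc _ y y ⟩
        y ∙ x ⁻¹ ∙ (y ∙ y)                ≡⟨ cong (y ∙ x ⁻¹ ∙_) (x∙x≡x⁻¹ y) ⟩
        y ∙ x ⁻¹ ∙ y ⁻¹                   ∎

      rhs : y ⁻¹ ∙ x ∙ y ∙ x ≡ y ∙ x ⁻¹ ∙ y ⁻¹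
      rhs = begin
        y ⁻¹ ∙ x ∙ y ∙ x                  ≡⟨ cong (_∙ x) (assoc (y ⁻¹) x y) ⟩
        y ⁻¹ ∙ (x ∙ y) ∙ x                ≡⟨ assoc (y ⁻¹) _ x ⟩
        y ⁻¹ ∙ (x ∙ y ∙ x)                ≡⟨ cong (y ⁻¹ ∙_) (x∙y∙x x y) ⟩
        y ⁻¹ ∙ (y ⁻¹ ∙ x ⁻¹ ∙ y ⁻¹)       ≡⟨ cong (y ⁻¹ ∙_) (assoc (y ⁻¹) (x ⁻¹) (y ⁻¹)) ⟩
        y ⁻¹ ∙ (y ⁻¹ ∙ (x ⁻¹ ∙ y ⁻¹))     ≡⟨ assoc (y ⁻¹) (y ⁻¹) _ ⟨
        y ⁻¹ ∙ y ⁻¹ ∙ (x ⁻¹ ∙ y ⁻¹)       ≡⟨ cong (_∙ (x ⁻¹ ∙ y ⁻¹)) (trans (x∙x≡x⁻¹ (y ⁻¹)) (⁻¹-involutive y)) ⟩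
        y ∙ (x ⁻¹ ∙ y ⁻¹)                 ≡⟨ assoc y (x ⁻¹) (y ⁻¹) ⟨
        y ∙ x ⁻¹ ∙ y ⁻¹                   ∎

    commutator-commutesˡ : ∀ x y → commutator x y ∙ x ≡ x ∙ commutator x y
    commutator-commutesˡ x y = begin
      x ⁻¹ ∙ y ⁻¹ ∙ x ∙ y ∙ x        ≡⟨ cong (_∙ x) (c≡x⁻¹∙d) ⟩
      x ⁻¹ ∙ d ∙ x                   ≡⟨ assoc (x ⁻¹) d x ⟩
      x ⁻¹ ∙ (d ∙ x)                 ≡⟨ cong (x ⁻¹ ∙_) (conjugate-commutes x y) ⟨
      x ⁻¹ ∙ (x ∙ d)                 ≡⟨ assoc (x ⁻¹) x d ⟨
      x ⁻¹ ∙ x ∙ d                   ≡⟨ cong (_∙ d) (trans (inverseˡ x) (sym (inverseʳ x))) ⟩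
      x ∙ x ⁻¹ ∙ d                   ≡⟨ assoc x (x ⁻¹) d ⟩
      x ∙ (x ⁻¹ ∙ d)                 ≡⟨ cong (x ∙_) c≡x⁻¹∙d ⟨
      x ∙ (x ⁻¹ ∙ y ⁻¹ ∙ x ∙ y)      ∎
      where
      d : Fin n
      d = y ⁻¹ ∙ x ∙ y
      c≡x⁻¹∙d : x ⁻¹ ∙ y ⁻¹ ∙ x ∙ y ≡ x ⁻¹ ∙ d
      c≡x⁻¹∙d = trans (cong (_∙ y) (assoc (x ⁻¹) (y ⁻¹) x)) (assoc (x ⁻¹) (y ⁻¹ ∙ x) y)

    commutator-commutesʳ : ∀ x y → commutator x y ∙ y ≡ y ∙ commutator x y
    commutator-commutesʳ x y = begin
      f ∙ y ∙ y      ≡⟨ cong (_∙ y) f∙y≡y∙f ⟩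
      y ∙ f ∙ y      ≡⟨ assoc y f y ⟩
      y ∙ (f ∙ y)    ∎
      where
      f : Fin n
      f = x ⁻¹ ∙ y ⁻¹ ∙ x
      f∙y≡y∙f : f ∙ y ≡ y ∙ f
      f∙y≡y∙f = sym (trans (cong (_∙ f) (sym (⁻¹-involutive y)))
                  (trans (commute-⁻¹ (conjugate-commutes (y ⁻¹) x)) (cong (f ∙_) (⁻¹-involutive y))))

    module Presentation {x y z : Fin n} (t : ℕ) (x∙y≡y∙x : x ∙ y ≡ y ∙ x) (x∙z≡z∙x : x ∙ z ≡ z ∙ x)
                        (z∙y≡xᵗ∙y∙z : z ∙ y ≡ x ^ t ∙ y ∙ z) where
      private
        module Inner = Extension (addMod 3) (λ k → x ^ toℕ k)
          (λ k k′ → trans (^-mod {d = 3} (exponent-3 x) (toℕ k + toℕ k′)) (^-+ x (toℕ k) (toℕ k′)))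
          id 0F (λ k → commute-^ (sym x∙y≡y∙x) (toℕ k)) (exponent-3 y)

        z∙yⁱ : ∀ i → z ∙ y ^ i ≡ x ^ (t * i) ∙ y ^ i ∙ z
        z∙yⁱ zero    = begin
          z ∙ ε                  ≡⟨ identityʳ z ⟩
          z                      ≡⟨ identityˡ z ⟨
          ε ∙ z                  ≡⟨ cong (_∙ z) (identityˡ ε) ⟨
          ε ∙ ε ∙ z              ≡⟨ cong (λ k → x ^ k ∙ ε ∙ z) (*-zeroʳ t) ⟨
          x ^ (t * 0) ∙ ε ∙ z    ∎
        z∙yⁱ (suc i) = begin
          z ∙ (y ∙ y ^ i)                         ≡⟨ assoc z y _ ⟨
          z ∙ y ∙ y ^ i                           ≡⟨ cong (_∙ y ^ i) z∙y≡xᵗ∙y∙z ⟩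
          x ^ t ∙ y ∙ z ∙ y ^ i                   ≡⟨ assoc _ z _ ⟩
          x ^ t ∙ y ∙ (z ∙ y ^ i)                 ≡⟨ cong (x ^ t ∙ y ∙_) (z∙yⁱ i) ⟩
          x ^ t ∙ y ∙ (x ^ (t * i) ∙ y ^ i ∙ z)   ≡⟨ assoc _ _ z ⟨
          x ^ t ∙ y ∙ (x ^ (t * i) ∙ y ^ i) ∙ z   ≡⟨ cong (_∙ z) (assoc (x ^ t) y _) ⟩
          x ^ t ∙ (y ∙ (x ^ (t * i) ∙ y ^ i)) ∙ z ≡⟨ cong (λ w → x ^ t ∙ w ∙ z) (assoc y _ _) ⟨
          x ^ t ∙ (y ∙ x ^ (t * i) ∙ y ^ i) ∙ z   ≡⟨ cong (λ w → x ^ t ∙ (w ∙ y ^ i) ∙ z) y∙xᵗⁱ≡xᵗⁱ∙y ⟩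
          x ^ t ∙ (x ^ (t * i) ∙ y ∙ y ^ i) ∙ z   ≡⟨ cong (λ w → x ^ t ∙ w ∙ z) (assoc _ y _) ⟩
          x ^ t ∙ (x ^ (t * i) ∙ y ^ suc i) ∙ z   ≡⟨ cong (_∙ z) (assoc (x ^ t) _ _) ⟨
          x ^ t ∙ x ^ (t * i) ∙ y ^ suc i ∙ z     ≡⟨ cong (λ w → w ∙ y ^ suc i ∙ z) (^-+ x t (t * i)) ⟨
          x ^ (t + t * i) ∙ y ^ suc i ∙ z         ≡⟨ cong (λ k → x ^ k ∙ y ^ suc i ∙ z) (*-suc t i) ⟨
          x ^ (t * suc i) ∙ y ^ suc i ∙ z         ∎
          where
          y∙xᵗⁱ≡xᵗⁱ∙y : y ∙ x ^ (t * i) ≡ x ^ (t * i) ∙ y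
          y∙xᵗⁱ≡xᵗⁱ∙y = commute-^ (sym x∙y≡y∙x) (t * i)

        z∙xᵏyⁱ : ∀ k i → z ∙ (x ^ k ∙ y ^ i) ≡ x ^ (k + t * i) ∙ y ^ i ∙ z
        z∙xᵏyⁱ k i = begin
          z ∙ (x ^ k ∙ y ^ i)                   ≡⟨ assoc z _ _ ⟨
          z ∙ x ^ k ∙ y ^ i                     ≡⟨ cong (_∙ y ^ i) (commute-^ (sym x∙z≡z∙x) k) ⟩
          x ^ k ∙ z ∙ y ^ i                     ≡⟨ assoc _ z _ ⟩
          x ^ k ∙ (z ∙ y ^ i)                   ≡⟨ cong (x ^ k ∙_) (z∙yⁱ i) ⟩
          x ^ k ∙ (x ^ (t * i) ∙ y ^ i ∙ z)     ≡⟨ assoc _ _ z ⟨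
          x ^ k ∙ (x ^ (t * i) ∙ y ^ i) ∙ z     ≡⟨ cong (_∙ z) (assoc _ _ _) ⟨
          x ^ k ∙ x ^ (t * i) ∙ y ^ i ∙ z       ≡⟨ cong (λ w → w ∙ y ^ i ∙ z) (^-+ x k (t * i)) ⟨
          x ^ (k + t * i) ∙ y ^ i ∙ z           ∎

        module Outer = Extension (extension (addMod 3) id 0F) Inner.φ Inner.φ-homo
          (λ (k , i) → (toℕ k + t * toℕ i) mod 3 , i) (0F , 0F)
          (λ (k , i) → trans (z∙xᵏyⁱ (toℕ k) (toℕ i))
                             (cong (λ w → w ∙ y ^ toℕ i ∙ z) (sym (^-mod {d = 3} (exponent-3 x) (toℕ k + t * toℕ i)))))
          (trans (exponent-3 z) (sym (identityˡ ε)))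

      open Outer public using (φ; φ-homo)

      φ-injective : x ≢ ε → (∀ (k : Fin 3) → x ^ toℕ k ≢ y) → (∀ (k i : Fin 3) → x ^ toℕ k ∙ y ^ toℕ i ≢ z) →
                    Injective _≡_ _≡_ φ
      φ-injective x≢ε y∉⟨x⟩ z∉⟨x,y⟩ =
        Outer.φ-injective (Inner.φ-injective xᵏ-injective y∉⟨x⟩) (λ (k , i) → z∉⟨x,y⟩ k i)
        where
        x-order : Order x 3
        x-order = order-p^[1+k] {k = 0} prime-3 (exponent-3 x) (x≢ε ∘ trans (sym (identityʳ x)))

        xᵏ-injective : Injective _≡_ _≡_ (λ (k : Fin 3) → x ^ toℕ k)
        xᵏ-injective = toℕ-injective ∘ ^-injective x-order (toℕ<n _) (toℕ<n _)


    module _ (n≡27 : n ≡ 27) {e} (σ : Fin 27 → Fin 27)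
             (tables : ∀ (t : Fin 2) →
                         MultiplicationTable.IsColouringTable enumeration₂₇ (heisenberg (toℕ t)) e σ) where
      private
        from-presentation : ∀ {x y z} (t : Fin 2) (x∙y≡y∙x : x ∙ y ≡ y ∙ x) (x∙z≡z∙x : x ∙ z ≡ z ∙ x)
                            (z∙y≡xᵗ∙y∙z : z ∙ y ≡ x ^ toℕ t ∙ y ∙ z) → x ≢ ε → (∀ (k : Fin 3) → x ^ toℕ k ≢ y) →
                            (∀ (k i : Fin 3) → x ^ toℕ k ∙ y ^ toℕ i ≢ z) → Colourable group
        from-presentation t x∙y≡y∙x x∙z≡z∙x z∙y≡xᵗ∙y∙z x≢ε y∉⟨x⟩ z∉⟨x,y⟩ =
          colourable-from-table enumeration₂₇ {heisenberg (toℕ t)} {e} φ φ-homo (φ-injective x≢ε y∉⟨x⟩ z∉⟨x,y⟩)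
            (sym n≡27) σ (tables t)
          where open Presentation (toℕ t) x∙y≡y∙x x∙z≡z∙x z∙y≡xᵗ∙y∙z

      abelian-colourable : (∀ x y → x ∙ y ≡ y ∙ x) → Colourable group
      abelian-colourable comm = with-a (outside (λ (_ : Fin 1) → ε) (<n (toWitness {a? = 1 <? 27} _)))
        where
        <n : ∀ {m} → m < 27 → m < n
        <n = subst (_ <_) (sym n≡27)

        with-a : ∃ (λ a → ∀ (_ : Fin 1) → ε ≢ a) → Colourable group
        with-a (a , a≢ε) = with-b (outside (λ (k : Fin 3) → a ^ toℕ k) (<n (toWitness {a? = 3 <? 27} _)))
          where
          with-b : ∃ (λ b → ∀ (k : Fin 3) → a ^ toℕ k ≢ b) → Colourable group
          with-b (b , b∉⟨a⟩) = with-c (outside aᵏbⁱ (<n (toWitness {a? = 9 <? 27} _)))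
            where
            aᵏbⁱ : Fin 9 → Fin n
            aᵏbⁱ l = a ^ toℕ (proj₁ (remQuot {3} 3 l)) ∙ b ^ toℕ (proj₂ (remQuot {3} 3 l))

            with-c : ∃ (λ c → ∀ l → aᵏbⁱ l ≢ c) → Colourable group
            with-c (c , c∉⟨a,b⟩) = from-presentation 0F (comm a b) (comm a c)
              (trans (comm c b) (cong (_∙ c) (sym (identityˡ b)))) (λ a≡ε → a≢ε zero (sym a≡ε)) b∉⟨a⟩
              (λ k i → subst (λ (k′ , i′) → a ^ toℕ k′ ∙ b ^ toℕ i′ ≢ c) (remQuot-combine k i) (c∉⟨a,b⟩ (combine k i)))

      nonabelian-colourable : ∀ {a b} → a ∙ b ≢ b ∙ a → Colourable group
      nonabelian-colourable {a} {b} ab≢ba =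
        from-presentation 1F (commutator-commutesʳ b a) (commutator-commutesˡ b a) b∙a≡c∙a∙b c≢ε a∉⟨c⟩ b∉⟨c,a⟩
        where
        c : Fin n
        c = commutator b a

        a∙c≡c∙a : a ∙ c ≡ c ∙ a
        a∙c≡c∙a = sym (commutator-commutesʳ b a)

        b∙a≡c∙a∙b : b ∙ a ≡ c ^ 1 ∙ a ∙ b
        b∙a≡c∙a∙b = begin
          b ∙ a              ≡⟨ ∙-commutator a b ⟩
          a ∙ b ∙ c          ≡⟨ assoc a b c ⟩
          a ∙ (b ∙ c)        ≡⟨ cong (a ∙_) (commutator-commutesˡ b a) ⟨
          a ∙ (c ∙ b)        ≡⟨ assoc a c b ⟨
          a ∙ c ∙ b          ≡⟨ cong (_∙ b) a∙c≡c∙a ⟩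
          c ∙ a ∙ b          ≡⟨ cong (λ w → w ∙ a ∙ b) (identityʳ c) ⟨
          c ^ 1 ∙ a ∙ b      ∎

        c≢ε : c ≢ ε
        c≢ε c≡ε = ab≢ba (sym (trans (∙-commutator a b) (trans (cong (a ∙ b ∙_) c≡ε) (identityʳ _))))

        a∉⟨c⟩ : ∀ (k : Fin 3) → c ^ toℕ k ≢ a
        a∉⟨c⟩ k cᵏ≡a = ab≢ba (subst (λ w → w ∙ b ≡ b ∙ w) cᵏ≡a
          (sym (commute-^ (sym (commutator-commutesˡ b a)) (toℕ k))))

        b∉⟨c,a⟩ : ∀ (k i : Fin 3) → c ^ toℕ k ∙ a ^ toℕ i ≢ b
        b∉⟨c,a⟩ k i cᵏaⁱ≡b = ab≢ba (subst (λ w → a ∙ w ≡ w ∙ a) cᵏaⁱ≡b (begin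
          a ∙ (c ^ toℕ k ∙ a ^ toℕ i)   ≡⟨ assoc a _ _ ⟨
          a ∙ c ^ toℕ k ∙ a ^ toℕ i     ≡⟨ cong (_∙ a ^ toℕ i) (commute-^ a∙c≡c∙a (toℕ k)) ⟩
          c ^ toℕ k ∙ a ∙ a ^ toℕ i     ≡⟨ assoc _ a _ ⟩
          c ^ toℕ k ∙ (a ∙ a ^ toℕ i)   ≡⟨ cong (c ^ toℕ k ∙_) (commute-^ refl (toℕ i)) ⟩
          c ^ toℕ k ∙ (a ^ toℕ i ∙ a)   ≡⟨ assoc _ _ a ⟨
          c ^ toℕ k ∙ a ^ toℕ i ∙ a     ∎))

      exponent-3-colourable : Colourable group
      exponent-3-colourable = by-commutativity (all? λ x → all? λ y → x ∙ y ≟ y ∙ x)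
        where
        by-commutativity : Dec (∀ x y → x ∙ y ≡ y ∙ x) → Colourable group
        by-commutativity (yes comm)  = abelian-colourable comm
        by-commutativity (no ¬comm) =
          let a , ¬∀y  = ¬∀⟶∃¬ n _ (λ x → all? λ y → x ∙ y ≟ y ∙ x) ¬comm
              b , ab≢ba = ¬∀⟶∃¬ n _ (λ y → a ∙ y ≟ y ∙ a) ¬∀y
          in nonabelian-colourable ab≢ba

-- The tables were found by a computer search; entry u of a table is the image of u in the coordinates of
-- `*↔×` or `enumeration₂₇`.  The decisions below check them.
fromTable : ∀ {k} .{{_ : NonZero k}} → Vec ℕ k → Fin k → Fin k
fromTable {k} t u = lookup t u mod k

σ₃ : Vec ℕ 9
σ₃ = 7 ∷ 5 ∷ 2 ∷ 8 ∷ 0 ∷ 4 ∷ 3 ∷ 1 ∷ 6 ∷ []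

σ₉ : Fin 9 → Fin 9 → Vec ℕ 27
σ₉ 1F _  = 3 ∷ 2 ∷ 12 ∷ 17 ∷ 25 ∷ 5 ∷ 11 ∷ 24 ∷ 20 ∷ 19 ∷ 9 ∷ 7 ∷ 0 ∷ 10 ∷ 22 ∷ 6 ∷ 21 ∷ 18 ∷ 14 ∷ 8 ∷ 26 ∷ 1 ∷ 4 ∷ 15 ∷ 16 ∷ 23 ∷ 13 ∷ []
σ₉ 4F 0F = 17 ∷ 12 ∷ 18 ∷ 15 ∷ 1 ∷ 11 ∷ 24 ∷ 7 ∷ 2 ∷ 13 ∷ 19 ∷ 25 ∷ 8 ∷ 21 ∷ 26 ∷ 4 ∷ 3 ∷ 16 ∷ 6 ∷ 20 ∷ 22 ∷ 14 ∷ 5 ∷ 0 ∷ 10 ∷ 23 ∷ 9 ∷ []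
σ₉ 4F 3F = 18 ∷ 3 ∷ 17 ∷ 12 ∷ 15 ∷ 1 ∷ 6 ∷ 0 ∷ 25 ∷ 11 ∷ 16 ∷ 24 ∷ 7 ∷ 26 ∷ 9 ∷ 8 ∷ 10 ∷ 21 ∷ 19 ∷ 22 ∷ 14 ∷ 13 ∷ 5 ∷ 2 ∷ 23 ∷ 20 ∷ 4 ∷ []
σ₉ 4F 6F = 25 ∷ 1 ∷ 26 ∷ 14 ∷ 6 ∷ 12 ∷ 24 ∷ 16 ∷ 23 ∷ 11 ∷ 22 ∷ 15 ∷ 13 ∷ 8 ∷ 7 ∷ 9 ∷ 20 ∷ 19 ∷ 3 ∷ 5 ∷ 18 ∷ 10 ∷ 0 ∷ 2 ∷ 17 ∷ 21 ∷ 4 ∷ []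
σ₉ 7F 0F = 24 ∷ 9 ∷ 18 ∷ 23 ∷ 5 ∷ 7 ∷ 20 ∷ 22 ∷ 26 ∷ 3 ∷ 15 ∷ 21 ∷ 25 ∷ 10 ∷ 14 ∷ 17 ∷ 2 ∷ 11 ∷ 0 ∷ 12 ∷ 6 ∷ 1 ∷ 16 ∷ 19 ∷ 13 ∷ 8 ∷ 4 ∷ []
σ₉ 7F 3F = 23 ∷ 17 ∷ 12 ∷ 18 ∷ 14 ∷ 7 ∷ 8 ∷ 24 ∷ 5 ∷ 2 ∷ 19 ∷ 9 ∷ 6 ∷ 11 ∷ 26 ∷ 16 ∷ 3 ∷ 22 ∷ 4 ∷ 25 ∷ 15 ∷ 21 ∷ 13 ∷ 10 ∷ 1 ∷ 0 ∷ 20 ∷ []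
σ₉ 7F 6F = 5 ∷ 7 ∷ 21 ∷ 22 ∷ 11 ∷ 16 ∷ 13 ∷ 8 ∷ 3 ∷ 0 ∷ 19 ∷ 23 ∷ 18 ∷ 10 ∷ 12 ∷ 9 ∷ 20 ∷ 4 ∷ 2 ∷ 6 ∷ 25 ∷ 14 ∷ 24 ∷ 17 ∷ 1 ∷ 15 ∷ 26 ∷ []
σ₉ _  _  = replicate 27 0  -- parameters excluded by r³ ≡ 1 and 3m ≡ 0 (mod 9)

σ₂₇ : Vec ℕ 27
σ₂₇ = 23 ∷ 4 ∷ 10 ∷ 7 ∷ 18 ∷ 15 ∷ 16 ∷ 20 ∷ 1 ∷ 21 ∷ 9 ∷ 6 ∷ 3 ∷ 13 ∷ 8 ∷ 12 ∷ 22 ∷ 26 ∷ 25 ∷ 11 ∷ 17 ∷ 14 ∷ 2 ∷ 19 ∷ 5 ∷ 0 ∷ 24 ∷ []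

module _ where
  open MultiplicationTable

  metacyclic₃-tables : ∀ (r m : Fin 3) → (toℕ r ℕ.^ 3) % 3 ≡ 1 → (toℕ m * 1) % 3 ≡ 0 →
                       IsColouringTable (*↔× {3} {3}) (metacyclic 3 r m) (0F , 0F) (fromTable σ₃)
  metacyclic₃-tables = toWitness {a? = all? λ r → all? λ m →
    ((toℕ r ℕ.^ 3) % 3 ≟ℕ 1) →-dec (((toℕ m * 1) % 3 ≟ℕ 0) →-dec
      isColouringTable? (*↔× {3} {3}) (metacyclic 3 r m) (0F , 0F) (fromTable σ₃))} _

  metacyclic₉-tables : ∀ (r m : Fin 9) → (toℕ r ℕ.^ 3) % 9 ≡ 1 → (toℕ m * 3) % 9 ≡ 0 →
                       IsColouringTable (*↔× {9} {3}) (metacyclic 9 r m) (0F , 0F) (fromTable (σ₉ r m))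
  metacyclic₉-tables = toWitness {a? = all? λ r → all? λ m →
    ((toℕ r ℕ.^ 3) % 9 ≟ℕ 1) →-dec (((toℕ m * 3) % 9 ≟ℕ 0) →-dec
      isColouringTable? (*↔× {9} {3}) (metacyclic 9 r m) (0F , 0F) (fromTable (σ₉ r m)))} _

  heisenberg-tables : ∀ (t : Fin 2) →
                      IsColouringTable enumeration₂₇ (heisenberg (toℕ t)) ((0F , 0F) , 0F) (fromTable σ₂₇)
  heisenberg-tables = toWitness {a? = all? λ t →
    isColouringTable? enumeration₂₇ (heisenberg (toℕ t)) ((0F , 0F) , 0F) (fromTable σ₂₇)} _

noncyclic-colourable : ∀ k (G : FinGroup (3 ℕ.^ k)) → 3 ℕ.^ k ≤ 27 →
                       ¬ IsCyclic (FinGroup.group G) → Colourable (FinGroup.group G)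
noncyclic-colourable 0 G _ noncyclic = contradiction (order-n⇒cyclic ε-order) noncyclic
  where
  open FinGroupTheory G

  ε-order : Order ε 1
  ε-order = let d , o = order ε in subst (Order ε) (∣1⇒≡1 (lagrange o)) o
noncyclic-colourable 1 G _ noncyclic =
  let x , x≢ε = outside (λ (_ : Fin 1) → ε) (toWitness {a? = 1 <? 3} _)
  in contradiction (trans (sym (identityʳ x)) (noncyclic⇒^p^k≡ε {k = 0} prime-3 refl noncyclic x)) (x≢ε zero ∘ sym)
  where open FinGroupTheory G
noncyclic-colourable 2 G _ noncyclic = with-a (outside (λ (_ : Fin 1) → ε) (toWitness {a? = 1 <? 9} _))
  where
  open FinGroupTheory G

  exponent-3 : ∀ x → x ^ 3 ≡ ε
  exponent-3 = noncyclic⇒^p^k≡ε {k = 1} prime-3 refl noncyclic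

  with-a : ∃ (λ a → ∀ (_ : Fin 1) → ε ≢ a) → Colourable group
  with-a (a , a≢ε) = metacyclic-colourable {p = 3} {q = 1} {h = 1} refl refl refl exponent-3
    (order-p^[1+k] {k = 0} prime-3 (exponent-3 a) (a≢ε zero ∘ sym ∘ trans (sym (identityʳ a)))) {e = 0F , 0F}
    (λ _ _ → fromTable σ₃) metacyclic₃-tables
noncyclic-colourable 3 G _ noncyclic = by-exponent (all? λ x → x ^ 3 ≟ ε)
  where
  open FinGroupTheory G

  exponent-9 : ∀ x → x ^ 9 ≡ ε
  exponent-9 = noncyclic⇒^p^k≡ε {k = 2} prime-3 refl noncyclic

  with-a : ∃ (λ a → a ^ 3 ≢ ε) → Colourable group
  with-a (a , a³≢ε) = metacyclic-colourable {p = 9} {q = 3} {h = 4} refl refl refl exponent-9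
    (order-p^[1+k] {k = 1} prime-3 (exponent-9 a) a³≢ε) {e = 0F , 0F} (λ r m → fromTable (σ₉ r m)) metacyclic₉-tables

  by-exponent : Dec (∀ x → x ^ 3 ≡ ε) → Colourable group
  by-exponent (yes exponent-3) =
    ExponentThree.exponent-3-colourable exponent-3 refl {e = (0F , 0F) , 0F} (fromTable σ₂₇) heisenberg-tables
  by-exponent (no ¬exponent-3) = with-a (¬∀⟶∃¬ 27 _ (λ x → x ^ 3 ≟ ε) ¬exponent-3)
noncyclic-colourable (suc (suc (suc (suc k)))) G 3^k≤27 _ =
  contradiction (≤-trans (^-monoʳ-≤ 3 (m≤m+n 4 k)) 3^k≤27) (<⇒≱ (toWitness {a? = 27 <? 81} _))

lemma2p1 : {c ℓ : Level} (G : Group c ℓ) →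
    Is3GroupOfOrder≤27 G → ¬ IsCyclic G → Colourable G
lemma2p1 G (k , I , 3^k≤27) noncyclic =
  colourable-transport iso (noncyclic-colourable k (finGroup G I) 3^k≤27 (noncyclic ∘ isCyclic-transport iso))
  where
  iso : GroupIsomorphism (FinGroup.group (finGroup G I)) G
  iso = finGroup-isomorphism G I
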